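{- For every integer $n\ge1$, $\operatorname{num}_{\mathcal O}(n,-1)=o(n!)$, where $o(M)$ denotes the largest odd divisor of a positive integer $M$.
   Context: An odd partition of $n$ is a partition of $n$ (a finite nonincreasing sequence of positive integers summing to $n$) all of whose parts are odd; let $\mathcal O(n)$ be the set of odd partitions of $n$, and let $m_\lambda(i)$ be the number of parts of $\lambda$ equal to $i$. For $\lambda\in\mathcal O(n)$ set $h_{\mathcal O,\lambda}(x)=\prod_{i\ge1,\ i\text{ odd}}(1+x^i)^{\lfloor n/i\rfloor-m_\lambda(i)}$, let $G_{\mathcal O}(n,x)$ be the greatest common divisor in $\mathbb{Z}[x]$ (positive leading coefficient) of the $h_{\mathcal O,\lambda}(x)$ over $\lambda\in\mathcal O(n)$, and define the polynomial $\operatorname{num}_{\mathcal O}(n,x)=\frac{1}{G_{\mathcal O}(n,x)}\sum_{\lambda\in\mathcal O(n)}h_{\mathcal O,\lambda}(x)$. -}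

module Defs where

open import Data.Nat as ℕ using (ℕ; zero; suc; _∸_; _≥_; _≤_; _<_; _!)
open import Data.Nat.DivMod using (_/_)
open import Data.Nat.Divisibility as ℕD using ()
open import Data.Integer as ℤ using (ℤ; +_; -_; _>_)
import Data.Integer.Divisibility as ℤD
open import Data.List using (List; []; _∷_; _++_; replicate; map; foldr; upTo)
open import Data.Nat.ListAction using (sum)
open import Data.List.Relation.Unary.All using (All)
open import Data.List.Relation.Unary.Linked using (Linked)
open import Data.List.Relation.Unary.Any using (Any)
open import Data.List.Relation.Unary.Unique.Propositional using (Unique)
open import Data.List.Membership.Propositional using (_∈_)
open import Data.Product using (Σ; ∃; _×_)
open import Relation.Nullary using (yes; no)
open import Relation.Binary.PropositionalEquality using (_≡_)
open import Function.Bundles using (_⇔_)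

Odd : ℕ → Set
Odd i = ∃ λ k → i ≡ suc (2 ℕ.* k)

IsOddPartition : ℕ → List ℕ → Set
IsOddPartition n λs = Linked _≥_ λs × All Odd λs × sum λs ≡ n

mult : List ℕ → ℕ → ℕ
mult [] i = 0
mult (p ∷ ps) i with p ℕ.≟ i
... | yes _ = suc (mult ps i)
... | no  _ = mult ps i

EnumeratesOddPartitions : ℕ → List (List ℕ) → Set
EnumeratesOddPartitions n L =
  Unique L × (∀ (λs : List ℕ) → (λs ∈ L) ⇔ IsOddPartition n λs)

-- Polynomials in ℤ[x], as coefficient lists (constant term first).
-- Equality is coefficientwise (trailing zeros irrelevant).

Poly : Set
Poly = List ℤ

coeff : Poly → ℕ → ℤ
coeff []       _       = + 0
coeff (a ∷ p)  zero    = a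
coeff (a ∷ p)  (suc k) = coeff p k

infix 4 _≈ₚ_
_≈ₚ_ : Poly → Poly → Set
p ≈ₚ q = ∀ k → coeff p k ≡ coeff q k

infixl 6 _+ₚ_
_+ₚ_ : Poly → Poly → Poly
[]      +ₚ q       = q
(a ∷ p) +ₚ []      = a ∷ p
(a ∷ p) +ₚ (b ∷ q) = (a ℤ.+ b) ∷ (p +ₚ q)

infixl 7 _*ₚ_
_*ₚ_ : Poly → Poly → Poly
[]      *ₚ q = []
(a ∷ p) *ₚ q = map (a ℤ.*_) q +ₚ (+ 0 ∷ (p *ₚ q))

oneₚ : Poly
oneₚ = + 1 ∷ []

xPow : ℕ → Poly
xPow i = replicate i (+ 0) ++ (+ 1 ∷ [])

_^ₚ_ : Poly → ℕ → Poly
p ^ₚ zero  = oneₚ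
p ^ₚ suc e = p *ₚ (p ^ₚ e)

sumₚ : List Poly → Poly
sumₚ = foldr _+ₚ_ []

prodₚ : List Poly → Poly
prodₚ = foldr _*ₚ_ oneₚ

eval : Poly → ℤ → ℤ
eval p x = foldr (λ a acc → a ℤ.+ x ℤ.* acc) (+ 0) p

infix 4 _∣ₚ_
_∣ₚ_ : Poly → Poly → Set
d ∣ₚ p = ∃ λ r → d *ₚ r ≈ₚ p

PositiveLeading : Poly → Set
PositiveLeading p = ∃ λ d → (coeff p d > + 0) × (∀ k → d < k → coeff p k ≡ + 0)

IsGCDₚ : List Poly → Poly → Set
IsGCDₚ ps G =
  All (G ∣ₚ_) ps × (∀ D → All (D ∣ₚ_) ps → D ∣ₚ G) × PositiveLeading G

-- h_{O,λ}(x) = ∏_{i odd} (1 + x^i)^(⌊n/i⌋ - m_λ(i)); factors with i > n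
-- equal 1, so it suffices to take i = 2k+1 for k < n.

hO : ℕ → List ℕ → Poly
hO n λs = prodₚ (map factor (upTo n))
  where
  factor : ℕ → Poly
  factor k = (oneₚ +ₚ xPow (suc (2 ℕ.* k))) ^ₚ ((n / suc (2 ℕ.* k)) ∸ mult λs (suc (2 ℕ.* k)))

IsLargestOddDivisor : ℕ → ℕ → Set
IsLargestOddDivisor d M =
  Odd d × (d ℕD.∣ M) × (∀ e → Odd e → e ℕD.∣ M → e ≤ d)

{-# OPTIONS --safe #-}
module Submission where

-- Write o(j) for the odd part of j and ψ a = 1 + (−x) + ⋯ + (−x)^(a−1), so that
-- 1 + x^a = (1 + x) · ψ a for odd a. Counting the multiples of i up to n gives
-- ∏_{i odd} (1 + x^i)^⌊n/i⌋ = D · ∏_{j ≤ n} (1 + x^o(j)) with D monic, and since exactly one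
-- of p consecutive integers is a multiple of p, cutting 1, …, n into consecutive blocks whose
-- sizes are the parts of λ gives ∏_j (1 + x^o(j)) = ∏_{p ∈ λ} (1 + x^p) · B_λ. Hence h_λ = D · B_λ.
-- The B_λ have gcd 1: by induction on odd m, every ideal containing all B_λ and ψ m contains
-- a positive integer (use the partition m^⌊n/m⌋ 1^(n mod m) and Bézout identities between the
-- ψ's). The ideal generated by a common divisor E of the B_λ contains B_{1ⁿ} = ∏_j ψ(o(j)), so E
-- divides a positive integer; it is then a constant, equal to 1 because G has a positive
-- leading coefficient and B_{1ⁿ}(0) = 1. So G = D and num(n, x) = Σ_λ B_λ. At x = −1 every
-- 1 + x^a with a odd vanishes, so only B_{1ⁿ} survives, with value ∏_j ψ(o(j))(−1) = ∏_j o(j) = o(n!).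

open import Defs
open import Data.Nat using (ℕ; _≥_; _!)
open import Data.Integer using (+_; -_)
open import Data.List using (List; map)
open import Data.Product using (Σ; _×_)
open import Relation.Binary.PropositionalEquality using (_≡_)

module RangeProducts where
  open import Algebra.Bundles using (CommutativeMonoid)
  open import Algebra.Definitions using (Zero)
  open import Data.Nat as ℕ using (ℕ; zero; suc; _+_; _≤_; _<_; z≤n; s≤s)
  import Data.Nat.Properties as ℕ
  open import Data.Product using (_×_; _,_; proj₁)
  open import Data.Empty using (⊥-elim)
  open import Function using (_∘_)
  open import Relation.Nullary using (¬_; yes; no)
  open import Relation.Binary.PropositionalEquality as ≡ using (_≡_; _≢_; cong; subst)

  module RangeProduct {c ℓ} (M : CommutativeMonoid c ℓ) where
    open CommutativeMonoid M
    open import Relation.Binary.Reasoning.Setoid setoid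
    open import Algebra.Properties.CommutativeSemigroup commutativeSemigroup using (interchange)

    ∏ : (ℕ → Carrier) → ℕ → ℕ → Carrier
    ∏ g s zero    = ε
    ∏ g s (suc p) = g s ∙ ∏ g (suc s) p

    InRange : ℕ → ℕ → ℕ → Set
    InRange s p j = s ≤ j × j < s + p

    private
      empty : ∀ {s j} → ¬ InRange s 0 j
      empty {s} {j} (s≤j , j<s+0) = ℕ.<⇒≱ (subst (j <_) (ℕ.+-identityʳ s) j<s+0) s≤j

      first : ∀ {s p} → InRange s (suc p) s
      first {s} = ℕ.≤-refl , ℕ.m<m+n s (s≤s z≤n)

      later : ∀ {s p j} → InRange (suc s) p j → InRange s (suc p) j
      later {s} {p} {j} (s<j , j<) = ℕ.<⇒≤ s<j , subst (j <_) (≡.sym (ℕ.+-suc s p)) j<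

      skip : ∀ {s p j} → s ≢ j → InRange s (suc p) j → InRange (suc s) p j
      skip {s} {p} {j} s≢j (s≤j , j<) = ℕ.≤∧≢⇒< s≤j s≢j , subst (j <_) (ℕ.+-suc s p) j<

    ∏-cong : ∀ {g h} s p → (∀ {j} → InRange s p j → g j ≈ h j) → ∏ g s p ≈ ∏ h s p
    ∏-cong s zero    g≈h = refl
    ∏-cong s (suc p) g≈h = ∙-cong (g≈h first) (∏-cong (suc s) p (g≈h ∘ later))

    ∏-ε : ∀ {g} s p → (∀ {j} → InRange s p j → g j ≈ ε) → ∏ g s p ≈ ε
    ∏-ε s zero    g≈ε = refl
    ∏-ε s (suc p) g≈ε = trans (∙-cong (g≈ε first) (∏-ε (suc s) p (g≈ε ∘ later))) (identityˡ ε)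

    ∏-single : ∀ {g} s p k → InRange s p k → (∀ {j} → InRange s p j → j ≢ k → g j ≈ ε) → ∏ g s p ≈ g k
    ∏-single s zero k k∈ _ = ⊥-elim (empty k∈)
    ∏-single {g} s (suc p) k k∈ others with s ℕ.≟ k
    ... | yes ≡.refl =
      trans (∙-congˡ (∏-ε (suc s) p λ j∈ → others (later j∈) (ℕ.<⇒≢ (proj₁ j∈) ∘ ≡.sym))) (identityʳ (g s))
    ... | no s≢k =
      trans (∙-congʳ (others first s≢k)) (trans (identityˡ _) (∏-single (suc s) p k (skip s≢k k∈) (others ∘ later)))

    ∏-zero : ∀ {z} → Zero _≈_ z _∙_ → ∀ {g} s p k → InRange s p k → g k ≈ z → ∏ g s p ≈ z
    ∏-zero _ s zero k k∈ _ = ⊥-elim (empty k∈)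
    ∏-zero (zeroˡ , zeroʳ) s (suc p) k k∈ gk≈z with s ℕ.≟ k
    ... | yes ≡.refl = trans (∙-congʳ gk≈z) (zeroˡ _)
    ... | no s≢k     = trans (∙-congˡ (∏-zero (zeroˡ , zeroʳ) (suc s) p k (skip s≢k k∈) gk≈z)) (zeroʳ _)

    ∏-+ : ∀ g s p q → ∏ g s (p + q) ≈ ∏ g s p ∙ ∏ g (s + p) q
    ∏-+ g s zero    q = begin
      ∏ g s q           ≡⟨ cong (λ t → ∏ g t q) (≡.sym (ℕ.+-identityʳ s)) ⟩
      ∏ g (s + 0) q     ≈⟨ identityˡ _ ⟨
      ε ∙ ∏ g (s + 0) q ∎
    ∏-+ g s (suc p) q = begin
      g s ∙ ∏ g (suc s) (p + q)                   ≈⟨ ∙-congˡ (∏-+ g (suc s) p q) ⟩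
      g s ∙ (∏ g (suc s) p ∙ ∏ g (suc s + p) q)   ≈⟨ assoc _ _ _ ⟨
      (g s ∙ ∏ g (suc s) p) ∙ ∏ g (suc s + p) q
        ≡⟨ cong (λ t → (g s ∙ ∏ g (suc s) p) ∙ ∏ g t q) (≡.sym (ℕ.+-suc s p)) ⟩
      (g s ∙ ∏ g (suc s) p) ∙ ∏ g (s + suc p) q   ∎

    ∏-last : ∀ g s p → ∏ g s (suc p) ≈ ∏ g s p ∙ g (s + p)
    ∏-last g s p = begin
      ∏ g s (suc p)             ≡⟨ cong (∏ g s) (ℕ.+-comm 1 p) ⟩
      ∏ g s (p + 1)             ≈⟨ ∏-+ g s p 1 ⟩
      ∏ g s p ∙ (g (s + p) ∙ ε) ≈⟨ ∙-congˡ (identityʳ (g (s + p))) ⟩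
      ∏ g s p ∙ g (s + p)       ∎

    ∏-shift : ∀ g s p → ∏ g (suc s) p ≡ ∏ (g ∘ suc) s p
    ∏-shift g s zero    = ≡.refl
    ∏-shift g s (suc p) = cong (g (suc s) ∙_) (∏-shift g (suc s) p)

    ∏-∙ : ∀ g h s p → ∏ (λ j → g j ∙ h j) s p ≈ ∏ g s p ∙ ∏ h s p
    ∏-∙ g h s zero    = sym (identityˡ ε)
    ∏-∙ g h s (suc p) = trans (∙-congˡ (∏-∙ g h (suc s) p)) (interchange _ _ _ _)

    ∏-comm : ∀ (G : ℕ → ℕ → Carrier) s p t q →
             ∏ (λ j → ∏ (G j) t q) s p ≈ ∏ (λ k → ∏ (λ j → G j k) s p) t q
    ∏-comm G s zero    t q = sym (∏-ε {λ _ → ε} t q (λ _ → refl))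
    ∏-comm G s (suc p) t q =
      trans (∙-congˡ (∏-comm G (suc s) p t q)) (sym (∏-∙ (G s) (λ k → ∏ (λ j → G j k) (suc s) p) t q))

    ∏-preserves : ∀ {ℓ′} {P : Carrier → Set ℓ′} → P ε → (∀ {x y} → P x → P y → P (x ∙ y)) →
                  ∀ {g} s p → (∀ {j} → InRange s p j → P (g j)) → P (∏ g s p)
    ∏-preserves Pε P∙ s zero    Pg = Pε
    ∏-preserves {P = P} Pε P∙ {g} s (suc p) Pg =
      P∙ (Pg first) (∏-preserves {P = P} Pε P∙ {g} (suc s) p (Pg ∘ later))

  module _ {c₁ ℓ₁ c₂ ℓ₂} (M : CommutativeMonoid c₁ ℓ₁) (N : CommutativeMonoid c₂ ℓ₂) where
    private
      module M = CommutativeMonoid M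
      module N = CommutativeMonoid N
      module ∏M = RangeProduct M
      module ∏N = RangeProduct N

    ∏-homo : ∀ (h : M.Carrier → N.Carrier) → h M.ε N.≈ N.ε → (∀ x y → h (x M.∙ y) N.≈ h x N.∙ h y) →
             ∀ g s p → h (∏M.∏ g s p) N.≈ ∏N.∏ (h ∘ g) s p
    ∏-homo h h-ε h-∙ g s zero    = h-ε
    ∏-homo h h-ε h-∙ g s (suc p) = N.trans (h-∙ (g s) _) (N.∙-congˡ (∏-homo h h-ε h-∙ g (suc s) p))

module OddParts where
  open import Data.Nat as ℕ using (ℕ; zero; suc; _+_; _*_; _^_; _<_; _≤_; z≤n; s≤s; NonZero)
  import Data.Nat.Properties as ℕ
  open import Data.Nat.Divisibility as ℕ using (_∣_; divides)
  open import Data.Nat.Induction using (<-rec)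
  open import Data.Nat.Solver using (module +-*-Solver)
  open import Data.Product using (Σ; ∃; ∃₂; _×_; _,_; proj₁; proj₂)
  open import Data.Sum using (_⊎_; inj₁; inj₂)
  open import Data.Empty using (⊥-elim)
  open import Relation.Binary.PropositionalEquality as ≡ using (_≡_; _≢_; refl; sym; trans; cong; subst)
  open +-*-Solver using (solve; _:+_; _:*_; _:=_; con)

  odd⇒nonZero : ∀ {d} → Odd d → NonZero d
  odd⇒nonZero (k , refl) = _

  odd⇒1≤ : ∀ {d} → Odd d → 1 ≤ d
  odd⇒1≤ (k , refl) = s≤s z≤n

  odd≢1⇒2≤ : ∀ {d} → Odd d → d ≢ 1 → 2 ≤ d
  odd≢1⇒2≤ (zero  , refl) d≢1 = ⊥-elim (d≢1 refl)
  odd≢1⇒2≤ (suc k , refl) _   = s≤s (s≤s z≤n)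

  odd-* : ∀ {a b} → Odd a → Odd b → Odd (a * b)
  odd-* (i , refl) (j , refl) = i + j + 2 * i * j , solve 2
    (λ i j → (con 1 :+ con 2 :* i) :* (con 1 :+ con 2 :* j) := con 1 :+ con 2 :* (i :+ j :+ con 2 :* i :* j)) refl i j

  even-or-odd : ∀ n → (∃ λ k → n ≡ 2 * k) ⊎ Odd n
  even-or-odd zero    = inj₁ (0 , refl)
  even-or-odd (suc n) with even-or-odd n
  ... | inj₁ (k , refl) = inj₂ (k , refl)
  ... | inj₂ (k , refl) = inj₁ (suc k , sym (ℕ.*-suc 2 k))

  even≢odd : ∀ a b → 2 * a ≢ suc (2 * b)
  even≢odd (suc a) (suc b) eq =
    even≢odd a b (ℕ.suc-injective (ℕ.suc-injective (trans (sym (ℕ.*-suc 2 a)) (trans eq (cong suc (ℕ.*-suc 2 b))))))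
  even≢odd (suc zero)      zero ()
  even≢odd (suc (suc a))   zero ()

  ∣odd⇒odd : ∀ {d m} → d ∣ m → Odd m → Odd d
  ∣odd⇒odd {d} (divides q refl) (b , eq) with even-or-odd d
  ... | inj₂ odd = odd
  ... | inj₁ (k , refl) = ⊥-elim (even≢odd (q * k) b (trans (solve 2 (λ q k → con 2 :* (q :* k) := q :* (con 2 :* k)) refl q k) eq))

  odd∣2*⇒∣ : ∀ {d m} → Odd d → d ∣ 2 * m → d ∣ m
  odd∣2*⇒∣ {d} {m} (k , refl) d∣2m =
    ℕ.∣m+n∣m⇒∣n (subst (d ∣_) dm≡k2m+m (ℕ.∣m⇒∣m*n m ℕ.∣-refl)) (ℕ.∣n⇒∣m*n k d∣2m)
    where
    dm≡k2m+m : d * m ≡ k * (2 * m) + m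
    dm≡k2m+m = solve 2 (λ k m → (con 1 :+ con 2 :* k) :* m := k :* (con 2 :* m) :+ m) refl k m

  odd∣2^*⇒∣ : ∀ {d m} a → Odd d → d ∣ 2 ^ a * m → d ∣ m
  odd∣2^*⇒∣ {d} {m} zero    odd d∣m = subst (d ∣_) (ℕ.+-identityʳ m) d∣m
  odd∣2^*⇒∣ {d} {m} (suc a) odd d∣2m = odd∣2^*⇒∣ a odd (odd∣2*⇒∣ odd (subst (d ∣_) (ℕ.*-assoc 2 (2 ^ a) m) d∣2m))

  oddDecomposition : ∀ n → .{{NonZero n}} → ∃₂ λ a o → Odd o × n ≡ 2 ^ a * o
  oddDecomposition = <-rec (λ n → .{{NonZero n}} → ∃₂ λ a o → Odd o × n ≡ 2 ^ a * o) step
    where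
    step : ∀ n → (∀ {m} → m < n → .{{NonZero m}} → ∃₂ λ a o → Odd o × m ≡ 2 ^ a * o) →
           .{{NonZero n}} → ∃₂ λ a o → Odd o × n ≡ 2 ^ a * o
    step n rec with even-or-odd n
    ... | inj₂ odd = 0 , n , odd , sym (ℕ.*-identityˡ n)
    ... | inj₁ (k@(suc _) , refl) with rec {k} (ℕ.m<m+n k (s≤s z≤n))
    ...   | a , o , odd , k≡2^a*o = suc a , o , odd , trans (cong (2 *_) k≡2^a*o) (sym (ℕ.*-assoc 2 (2 ^ a) o))

  -- oddPart 0 = 0 is a junk value.
  oddPart : ℕ → ℕ
  oddPart zero    = 0
  oddPart (suc j) = proj₁ (proj₂ (oddDecomposition (suc j)))

  oddPart-odd : ∀ j → Odd (oddPart (suc j))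
  oddPart-odd j = proj₁ (proj₂ (proj₂ (oddDecomposition (suc j))))

  oddPart-decomposition : ∀ j → ∃ λ a → suc j ≡ 2 ^ a * oddPart (suc j)
  oddPart-decomposition j = proj₁ d , proj₂ (proj₂ (proj₂ d))
    where d = oddDecomposition (suc j)

  oddPart∣ : ∀ j → oddPart (suc j) ∣ suc j
  oddPart∣ j = divides (2 ^ a) j+1≡
    where open Σ (oddPart-decomposition j) renaming (proj₁ to a; proj₂ to j+1≡)

  odd∣⇒∣oddPart : ∀ {d} j → Odd d → d ∣ suc j → d ∣ oddPart (suc j)
  odd∣⇒∣oddPart {d} j odd d∣j = odd∣2^*⇒∣ a odd (subst (d ∣_) j+1≡ d∣j)
    where open Σ (oddPart-decomposition j) renaming (proj₁ to a; proj₂ to j+1≡)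

module Multiples where
  open RangeProducts
  open import Data.Nat as ℕ using (ℕ; zero; suc; _+_; _∸_; _<_; _≤_; z≤n; s≤s; NonZero)
  import Data.Nat.Properties as ℕ
  open import Data.Nat.DivMod using (_/_; m<n⇒m/n≡0; m/n≡1+[m∸n]/n)
  open import Data.Nat.Divisibility as ℕ using (_∣_; _∣?_)
  open import Data.Nat.Induction using (<-rec)
  open import Data.Product using (_,_)
  open import Data.Empty using (⊥-elim)
  open import Relation.Nullary using (Dec; yes; no; ¬_)
  open import Relation.Binary.PropositionalEquality as ≡ using (_≡_; refl; sym; trans; cong; cong₂; subst)

  open RangeProduct ℕ.+-0-commutativeMonoid public using ()
    renaming (∏ to ∑; ∏-cong to ∑-cong; ∏-ε to ∑-0; ∏-+ to ∑-+; ∏-last to ∑-last)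

  indicator : ∀ {A : Set} → Dec A → ℕ
  indicator (yes _) = 1
  indicator (no  _) = 0

  indicator-yes : ∀ {A : Set} → A → (a? : Dec A) → indicator a? ≡ 1
  indicator-yes a (yes _) = refl
  indicator-yes a (no ¬a) = ⊥-elim (¬a a)

  indicator-no : ∀ {A : Set} → ¬ A → (a? : Dec A) → indicator a? ≡ 0
  indicator-no ¬a (yes a) = ⊥-elim (¬a a)
  indicator-no ¬a (no _)  = refl

  indicator-mono : ∀ {A B : Set} → (A → B) → (a? : Dec A) (b? : Dec B) → indicator a? ≤ indicator b?
  indicator-mono A→B (yes a) b? = ℕ.≤-reflexive (sym (indicator-yes (A→B a) b?))
  indicator-mono A→B (no _)  b? = z≤n

  indicator-cong : ∀ {A B : Set} → (A → B) → (B → A) → (a? : Dec A) (b? : Dec B) → indicator a? ≡ indicator b?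
  indicator-cong A→B B→A a? b? = ℕ.≤-antisym (indicator-mono A→B a? b?) (indicator-mono B→A b? a?)

  ∑-mono-≤ : ∀ {f g} → (∀ j → f j ≤ g j) → ∀ s p → ∑ f s p ≤ ∑ g s p
  ∑-mono-≤ f≤g s zero    = z≤n
  ∑-mono-≤ f≤g s (suc p) = ℕ.+-mono-≤ (f≤g s) (∑-mono-≤ f≤g (suc s) p)

  multiplesOf : ℕ → ℕ → ℕ
  multiplesOf d j = indicator (d ∣? suc j)

  count-multiples-block : ∀ d .{{_ : NonZero d}} s → ∑ (multiplesOf d) s d ≡ 1
  count-multiples-block d@(suc d′) zero = begin
    ∑ (multiplesOf d) 0 d
      ≡⟨ ∑-last (multiplesOf d) 0 d′ ⟩
    ∑ (multiplesOf d) 0 d′ + multiplesOf d d′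
      ≡⟨ cong₂ _+_ (∑-0 0 d′ λ (_ , j<d′) → indicator-no (too-small j<d′) _) (indicator-yes ℕ.∣-refl _) ⟩
    1 ∎
    where
    open ≡.≡-Reasoning
    too-small : ∀ {j} → j < d′ → ¬ d ∣ suc j
    too-small j<d′ d∣j+1 = ℕ.<⇒≱ j<d′ (ℕ.≤-pred (ℕ.∣⇒≤ d∣j+1))
  count-multiples-block d (suc s) = ℕ.+-cancelˡ-≡ (multiplesOf d s) _ _ (begin
    ∑ (multiplesOf d) s (suc d)
      ≡⟨ ∑-last (multiplesOf d) s d ⟩
    ∑ (multiplesOf d) s d + multiplesOf d (s + d)
      ≡⟨ cong₂ _+_ (count-multiples-block d s) periodic ⟩
    1 + multiplesOf d s
      ≡⟨ ℕ.+-comm 1 _ ⟩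
    multiplesOf d s + 1 ∎)
    where
    open ≡.≡-Reasoning
    periodic : multiplesOf d (s + d) ≡ multiplesOf d s
    periodic = indicator-cong (λ d∣ → ℕ.∣m+n∣m⇒∣n (subst (d ∣_) (ℕ.+-comm (suc s) d) d∣) ℕ.∣-refl)
                              (λ d∣ → ℕ.∣m∣n⇒∣m+n d∣ ℕ.∣-refl) _ _

  count-multiples : ∀ d .{{_ : NonZero d}} n → ∑ (multiplesOf d) 0 n ≡ n / d
  count-multiples d = <-rec _ step
    where
    step : ∀ n → (∀ {m} → m < n → ∑ (multiplesOf d) 0 m ≡ m / d) → ∑ (multiplesOf d) 0 n ≡ n / d
    step n rec with n ℕ.<? d
    ... | yes n<d = trans (∑-0 0 n λ (_ , j<n) → indicator-no (λ d∣ → ℕ.<⇒≱ (ℕ.<-≤-trans (s≤s j<n) n<d) (ℕ.∣⇒≤ d∣)) _)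
                          (sym (m<n⇒m/n≡0 n<d))
    ... | no n≮d = begin
      ∑ (multiplesOf d) 0 n
        ≡⟨ cong (∑ (multiplesOf d) 0) (sym (ℕ.m∸n+n≡m d≤n)) ⟩
      ∑ (multiplesOf d) 0 (n ∸ d + d)
        ≡⟨ ∑-+ (multiplesOf d) 0 (n ∸ d) d ⟩
      ∑ (multiplesOf d) 0 (n ∸ d) + ∑ (multiplesOf d) (n ∸ d) d
        ≡⟨ cong₂ _+_ (rec (ℕ.∸-monoʳ-< {n} {d} {0} (ℕ.>-nonZero⁻¹ d) d≤n)) (count-multiples-block d (n ∸ d)) ⟩
      (n ∸ d) / d + 1
        ≡⟨ ℕ.+-comm _ 1 ⟩
      1 + (n ∸ d) / d
        ≡⟨ m/n≡1+[m∸n]/n d≤n ⟨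
      n / d ∎
      where
      open ≡.≡-Reasoning
      d≤n = ℕ.≮⇒≥ n≮d

  ¬∣-between-multiples : ∀ {m j} k {r} → r < m → k ℕ.* m ≤ j → j < k ℕ.* m ℕ.+ r → ¬ m ∣ suc j
  ¬∣-between-multiples {m} {j} k {r} r<m km≤j j<km+r m∣j+1 =
    ℕ.<⇒≱ (ℕ.<-≤-trans (s≤s i<r) r<m) (ℕ.∣⇒≤ (ℕ.∣m+n∣m⇒∣n (subst (m ∣_) j+1≡km+suc-i m∣j+1) (ℕ.n∣m*n k)))
    where
    i = j ∸ k ℕ.* m
    km+i≡j : k ℕ.* m ℕ.+ i ≡ j
    km+i≡j = ℕ.m+[n∸m]≡n km≤j
    j+1≡km+suc-i : suc j ≡ k ℕ.* m ℕ.+ suc i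
    j+1≡km+suc-i = trans (cong suc (sym km+i≡j)) (sym (ℕ.+-suc (k ℕ.* m) i))
    i<r : i < r
    i<r = ℕ.+-cancelˡ-< (k ℕ.* m) i r (subst (_< k ℕ.* m ℕ.+ r) (sym km+i≡j) j<km+r)

module OddFactorial where
  open RangeProducts
  open OddParts
  open import Data.Nat as ℕ using (ℕ; zero; suc; _*_; _^_; _!)
  import Data.Nat.Properties as ℕ
  open import Data.Nat.Divisibility as ℕ using (_∣_; divides)
  open import Data.Nat.Solver using (module +-*-Solver)
  open import Data.Product using (∃; _,_)
  open import Relation.Binary.PropositionalEquality as ≡ using (_≡_; refl; sym; cong₂; subst)

  open RangeProduct ℕ.*-1-commutativeMonoid public using ()
    renaming (∏ to ∏ℕ; ∏-last to ∏ℕ-last; ∏-preserves to ∏ℕ-preserves)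

  oddFactorial : ℕ → ℕ
  oddFactorial n = ∏ℕ (λ j → oddPart (suc j)) 0 n

  odd-oddFactorial : ∀ n → Odd (oddFactorial n)
  odd-oddFactorial n = ∏ℕ-preserves {P = Odd} (0 , refl) odd-* 0 n (λ {j} _ → oddPart-odd j)

  factorial≡2^*oddFactorial : ∀ n → ∃ λ a → n ! ≡ 2 ^ a * oddFactorial n
  factorial≡2^*oddFactorial zero    = 0 , refl
  factorial≡2^*oddFactorial (suc n) with factorial≡2^*oddFactorial n | oddPart-decomposition n
  ... | a , n!≡ | b , n+1≡ = b ℕ.+ a , (begin
    suc n * n !
      ≡⟨ cong₂ _*_ n+1≡ n!≡ ⟩
    (2 ^ b * oddPart (suc n)) * (2 ^ a * oddFactorial n)
      ≡⟨ solve 4 (λ x y o f → (x :* o) :* (y :* f) := (x :* y) :* (f :* o)) refl (2 ^ b) (2 ^ a) (oddPart (suc n)) (oddFactorial n) ⟩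
    (2 ^ b * 2 ^ a) * (oddFactorial n * oddPart (suc n))
      ≡⟨ cong₂ _*_ (sym (ℕ.^-distribˡ-+-* 2 b a)) (sym (∏ℕ-last (λ j → oddPart (suc j)) 0 n)) ⟩
    2 ^ (b ℕ.+ a) * oddFactorial (suc n) ∎)
    where
    open ≡.≡-Reasoning
    open +-*-Solver using (solve; _:*_; _:=_)

  oddFactorial-largestOddDivisor : ∀ n → IsLargestOddDivisor (oddFactorial n) (n !)
  oddFactorial-largestOddDivisor n with factorial≡2^*oddFactorial n
  ... | a , n!≡ = odd-oddFactorial n , divides (2 ^ a) n!≡ ,
    λ e odd-e e∣n! → ℕ.∣⇒≤ ⦃ odd⇒nonZero (odd-oddFactorial n) ⦄ (odd∣2^*⇒∣ a odd-e (subst (e ∣_) n!≡ e∣n!))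

module OddPartitions where
  open OddParts using (odd⇒1≤)
  open import Data.Nat as ℕ using (ℕ; zero; suc; _≤_; _≥_)
  import Data.Nat.Properties as ℕ
  open import Data.List using ([]; _∷_; _++_; replicate)
  open import Data.Nat.ListAction using (sum)
  open import Data.Nat.ListAction.Properties using (sum-++)
  open import Data.List.Relation.Unary.All as All using (All; []; _∷_)
  import Data.List.Relation.Unary.All.Properties as All
  open import Data.List.Relation.Unary.Linked using (Linked; []; [-]; _∷_)
  open import Data.Product using (_,_)
  open import Relation.Binary.PropositionalEquality using (_≡_; refl; trans; cong; cong₂)

  sum-replicate : ∀ k m → sum (replicate k m) ≡ k ℕ.* m
  sum-replicate zero    m = refl
  sum-replicate (suc k) m = cong (m ℕ.+_) (sum-replicate k m)

  linked-ones : ∀ r → Linked _≥_ (replicate r 1)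
  linked-ones zero          = []
  linked-ones (suc zero)    = [-]
  linked-ones (suc (suc r)) = ℕ.≤-refl ∷ linked-ones (suc r)

  linked-replicate++ones : ∀ {m} k r → 1 ≤ m → Linked _≥_ (replicate k m ++ replicate r 1)
  linked-replicate++ones zero          r       _   = linked-ones r
  linked-replicate++ones (suc zero)    zero    _   = [-]
  linked-replicate++ones (suc zero)    (suc r) 1≤m = 1≤m ∷ linked-ones (suc r)
  linked-replicate++ones (suc (suc k)) r       1≤m = ℕ.≤-refl ∷ linked-replicate++ones (suc k) r 1≤m

  replicate++ones-isOddPartition : ∀ {n m} k r → Odd m → k ℕ.* m ℕ.+ r ≡ n → IsOddPartition n (replicate k m ++ replicate r 1)
  replicate++ones-isOddPartition {m = m} k r odd-m km+r≡n =
    linked-replicate++ones k r (odd⇒1≤ odd-m) ,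
    All.++⁺ (All.replicate⁺ k odd-m) (All.replicate⁺ r (0 , refl)) ,
    trans (sum-++ (replicate k m) (replicate r 1))
          (trans (cong₂ ℕ._+_ (sum-replicate k m) (trans (sum-replicate r 1) (ℕ.*-identityʳ r))) km+r≡n)

  all-ones : ∀ {ps} → All (_≡ 1) ps → ps ≡ replicate (sum ps) 1
  all-ones []          = refl
  all-ones (refl ∷ ones) = cong (1 ∷_) (all-ones ones)

module PolynomialRing where
  open import Level using (0ℓ)
  open import Algebra.Bundles using (CommutativeRing)
  open import Algebra.Structures using (IsCommutativeRing)
  open import Data.Nat as ℕ using (zero; suc)
  open import Data.Integer as ℤ using (ℤ; +_; -_)
  import Data.Integer.Properties as ℤ
  open import Data.Integer.Solver using (module +-*-Solver)
  open import Data.List using ([]; _∷_; map)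
  open import Data.Product using (_,_)
  open import Relation.Binary.PropositionalEquality as ≡ using (_≡_; refl; sym; trans; cong; cong₂)

  -- Wrapping `_≈ₚ_` in a record lets Agda infer the two polynomials from the type.
  infix 4 _≋_
  record _≋_ (p q : Poly) : Set where
    constructor coeffwise
    field coeff-≡ : p ≈ₚ q
  open _≋_ public

  infix 8 -ₚ_
  -ₚ_ : Poly → Poly
  -ₚ_ = map -_

  module _ where
    open import Data.Integer.Base using (_+_; _*_)
    open +-*-Solver
    open ≡.≡-Reasoning

    coeff-+ₚ : ∀ p q k → coeff (p +ₚ q) k ≡ coeff p k + coeff q k
    coeff-+ₚ []      q       k       = sym (ℤ.+-identityˡ _)
    coeff-+ₚ (a ∷ p) []      k       = sym (ℤ.+-identityʳ _)
    coeff-+ₚ (a ∷ p) (b ∷ q) zero    = refl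
    coeff-+ₚ (a ∷ p) (b ∷ q) (suc k) = coeff-+ₚ p q k

    coeff-map : ∀ (f : ℤ → ℤ) → f (+ 0) ≡ + 0 → ∀ p k → coeff (map f p) k ≡ f (coeff p k)
    coeff-map f f0 []      k       = sym f0
    coeff-map f f0 (a ∷ p) zero    = refl
    coeff-map f f0 (a ∷ p) (suc k) = coeff-map f f0 p k

    coeff-scale : ∀ a p k → coeff (map (a *_) p) k ≡ a * coeff p k
    coeff-scale a = coeff-map (a *_) (ℤ.*-zeroʳ a)

    coeff-∷ₚ-*ₚ : ∀ a p q k → coeff ((a ∷ p) *ₚ q) k ≡ a * coeff q k + coeff (+ 0 ∷ p *ₚ q) k
    coeff-∷ₚ-*ₚ a p q k = trans (coeff-+ₚ (map (a *_) q) _ k) (cong (_+ _) (coeff-scale a q k))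

    coeff-*ₚ-∷ : ∀ p a q k → coeff (p *ₚ (a ∷ q)) k ≡ a * coeff p k + coeff (+ 0 ∷ p *ₚ q) k
    coeff-*ₚ-∷ []      a q zero    = sym (cong (_+ + 0) (ℤ.*-zeroʳ a))
    coeff-*ₚ-∷ []      a q (suc k) = sym (cong (_+ + 0) (ℤ.*-zeroʳ a))
    coeff-*ₚ-∷ (b ∷ p) a q zero    = trans (coeff-∷ₚ-*ₚ b p (a ∷ q) zero) (cong (_+ + 0) (ℤ.*-comm b a))
    coeff-*ₚ-∷ (b ∷ p) a q (suc k) = begin
      coeff ((b ∷ p) *ₚ (a ∷ q)) (suc k)
        ≡⟨ coeff-∷ₚ-*ₚ b p (a ∷ q) (suc k) ⟩
      b * coeff q k + coeff (p *ₚ (a ∷ q)) k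
        ≡⟨ cong (_+_ (b * coeff q k)) (coeff-*ₚ-∷ p a q k) ⟩
      b * coeff q k + (a * coeff p k + coeff (+ 0 ∷ p *ₚ q) k)
        ≡⟨ solve 5 (λ a b x y z → b :* x :+ (a :* y :+ z) := a :* y :+ (b :* x :+ z)) refl a b (coeff q k) (coeff p k) _ ⟩
      a * coeff p k + (b * coeff q k + coeff (+ 0 ∷ p *ₚ q) k)
        ≡⟨ cong (_+_ (a * coeff p k)) (coeff-∷ₚ-*ₚ b p q k) ⟨
      a * coeff p k + coeff ((b ∷ p) *ₚ q) k
        ∎

    ≋-refl : ∀ {p} → p ≋ p
    ≋-refl = coeffwise λ _ → refl

    ≋-sym : ∀ {p q} → p ≋ q → q ≋ p
    ≋-sym (coeffwise e) = coeffwise λ k → sym (e k)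

    ≋-trans : ∀ {p q r} → p ≋ q → q ≋ r → p ≋ r
    ≋-trans (coeffwise e) (coeffwise f) = coeffwise λ k → trans (e k) (f k)

    ≋-reflexive : ∀ {p q} → p ≡ q → p ≋ q
    ≋-reflexive refl = ≋-refl

    ∷-cong : ∀ {a b p q} → a ≡ b → p ≋ q → a ∷ p ≋ b ∷ q
    ∷-cong a≡b (coeffwise e) = coeffwise λ { zero → a≡b ; (suc k) → e k }

    +ₚ-cong : ∀ {p p′ q q′} → p ≋ p′ → q ≋ q′ → p +ₚ q ≋ p′ +ₚ q′
    +ₚ-cong {p} {p′} {q} {q′} (coeffwise e) (coeffwise f) = coeffwise λ k → begin
      coeff (p +ₚ q) k      ≡⟨ coeff-+ₚ p q k ⟩
      coeff p k + coeff q k ≡⟨ cong₂ _+_ (e k) (f k) ⟩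
      coeff p′ k + coeff q′ k ≡⟨ coeff-+ₚ p′ q′ k ⟨
      coeff (p′ +ₚ q′) k    ∎

    +ₚ-congˡ : ∀ p {q q′} → q ≋ q′ → p +ₚ q ≋ p +ₚ q′
    +ₚ-congˡ p = +ₚ-cong (≋-refl {p})

    +ₚ-congʳ : ∀ {p p′} q → p ≋ p′ → p +ₚ q ≋ p′ +ₚ q
    +ₚ-congʳ q p≋p′ = +ₚ-cong p≋p′ (≋-refl {q})

    +ₚ-comm : ∀ p q → p +ₚ q ≋ q +ₚ p
    +ₚ-comm p q = coeffwise λ k →
      trans (coeff-+ₚ p q k) (trans (ℤ.+-comm (coeff p k) _) (sym (coeff-+ₚ q p k)))

    +ₚ-assoc : ∀ p q r → (p +ₚ q) +ₚ r ≋ p +ₚ (q +ₚ r)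
    +ₚ-assoc p q r = coeffwise λ k → begin
      coeff ((p +ₚ q) +ₚ r) k                ≡⟨ coeff-+ₚ (p +ₚ q) r k ⟩
      coeff (p +ₚ q) k + coeff r k           ≡⟨ cong (_+ coeff r k) (coeff-+ₚ p q k) ⟩
      coeff p k + coeff q k + coeff r k      ≡⟨ ℤ.+-assoc (coeff p k) _ _ ⟩
      coeff p k + (coeff q k + coeff r k)    ≡⟨ cong (_+_ (coeff p k)) (coeff-+ₚ q r k) ⟨
      coeff p k + coeff (q +ₚ r) k           ≡⟨ coeff-+ₚ p (q +ₚ r) k ⟨
      coeff (p +ₚ (q +ₚ r)) k                ∎

    +ₚ-identityʳ : ∀ p → p +ₚ [] ≋ p
    +ₚ-identityʳ []      = ≋-refl
    +ₚ-identityʳ (a ∷ p) = ≋-refl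

    -ₚ-inverseˡ : ∀ p → -ₚ p +ₚ p ≋ []
    -ₚ-inverseˡ p = coeffwise λ k → begin
      coeff (-ₚ p +ₚ p) k         ≡⟨ coeff-+ₚ (-ₚ p) p k ⟩
      coeff (-ₚ p) k + coeff p k  ≡⟨ cong (_+ coeff p k) (coeff-map -_ refl p k) ⟩
      - coeff p k + coeff p k     ≡⟨ ℤ.+-inverseˡ (coeff p k) ⟩
      + 0                         ∎

    -ₚ-cong : ∀ {p q} → p ≋ q → -ₚ p ≋ -ₚ q
    -ₚ-cong {p} {q} (coeffwise e) = coeffwise λ k →
      trans (coeff-map -_ refl p k) (trans (cong -_ (e k)) (sym (coeff-map -_ refl q k)))

    *ₚ-zeroʳ : ∀ p → p *ₚ [] ≋ []
    *ₚ-zeroʳ []      = ≋-refl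
    *ₚ-zeroʳ (a ∷ p) = coeffwise λ { zero → refl ; (suc k) → coeff-≡ (*ₚ-zeroʳ p) k }

    *ₚ-comm : ∀ p q → p *ₚ q ≋ q *ₚ p
    *ₚ-comm []      q = ≋-sym (*ₚ-zeroʳ q)
    *ₚ-comm (a ∷ p) q = coeffwise λ k → begin
      coeff ((a ∷ p) *ₚ q) k                       ≡⟨ coeff-∷ₚ-*ₚ a p q k ⟩
      a * coeff q k + coeff (+ 0 ∷ p *ₚ q) k
        ≡⟨ cong (_+_ (a * coeff q k)) (coeff-≡ (∷-cong refl (*ₚ-comm p q)) k) ⟩
      a * coeff q k + coeff (+ 0 ∷ q *ₚ p) k       ≡⟨ coeff-*ₚ-∷ q a p k ⟨
      coeff (q *ₚ (a ∷ p)) k                       ∎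

    *ₚ-congˡ : ∀ p {q q′} → q ≋ q′ → p *ₚ q ≋ p *ₚ q′
    *ₚ-congˡ []      q≋q′ = ≋-refl
    *ₚ-congˡ (a ∷ p) {q} {q′} q≋q′ = coeffwise λ k → begin
      coeff ((a ∷ p) *ₚ q) k                   ≡⟨ coeff-∷ₚ-*ₚ a p q k ⟩
      a * coeff q k + coeff (+ 0 ∷ p *ₚ q) k
        ≡⟨ cong₂ (λ u v → a * u + v) (coeff-≡ q≋q′ k) (coeff-≡ (∷-cong refl (*ₚ-congˡ p q≋q′)) k) ⟩
      a * coeff q′ k + coeff (+ 0 ∷ p *ₚ q′) k ≡⟨ coeff-∷ₚ-*ₚ a p q′ k ⟨
      coeff ((a ∷ p) *ₚ q′) k                  ∎

    *ₚ-congʳ : ∀ {p p′} q → p ≋ p′ → p *ₚ q ≋ p′ *ₚ q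
    *ₚ-congʳ {p} {p′} q p≋p′ =
      ≋-trans (*ₚ-comm p q) (≋-trans (*ₚ-congˡ q p≋p′) (*ₚ-comm q p′))

    *ₚ-distribʳ : ∀ r p q → (p +ₚ q) *ₚ r ≋ p *ₚ r +ₚ q *ₚ r
    *ₚ-distribʳ r []      q       = ≋-refl
    *ₚ-distribʳ r (a ∷ p) []      = ≋-sym (+ₚ-identityʳ _)
    *ₚ-distribʳ r (a ∷ p) (b ∷ q) = coeffwise λ k → begin
      coeff ((a + b ∷ p +ₚ q) *ₚ r) k
        ≡⟨ coeff-∷ₚ-*ₚ (a + b) (p +ₚ q) r k ⟩
      (a + b) * coeff r k + coeff (+ 0 ∷ (p +ₚ q) *ₚ r) k
        ≡⟨ cong (_+_ ((a + b) * coeff r k)) (coeff-≡ (∷-cong (sym (ℤ.+-identityʳ (+ 0))) (*ₚ-distribʳ r p q)) k) ⟩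
      (a + b) * coeff r k + coeff ((+ 0 ∷ p *ₚ r) +ₚ (+ 0 ∷ q *ₚ r)) k
        ≡⟨ cong (_+_ ((a + b) * coeff r k)) (coeff-+ₚ (+ 0 ∷ p *ₚ r) (+ 0 ∷ q *ₚ r) k) ⟩
      (a + b) * coeff r k + (coeff (+ 0 ∷ p *ₚ r) k + coeff (+ 0 ∷ q *ₚ r) k)
        ≡⟨ solve 5 (λ a b c x y → (a :+ b) :* c :+ (x :+ y) := (a :* c :+ x) :+ (b :* c :+ y)) refl a b (coeff r k) _ _ ⟩
      (a * coeff r k + coeff (+ 0 ∷ p *ₚ r) k) + (b * coeff r k + coeff (+ 0 ∷ q *ₚ r) k)
        ≡⟨ cong₂ _+_ (coeff-∷ₚ-*ₚ a p r k) (coeff-∷ₚ-*ₚ b q r k) ⟨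
      coeff ((a ∷ p) *ₚ r) k + coeff ((b ∷ q) *ₚ r) k
        ≡⟨ coeff-+ₚ ((a ∷ p) *ₚ r) _ k ⟨
      coeff ((a ∷ p) *ₚ r +ₚ (b ∷ q) *ₚ r) k
        ∎

    scale-*ₚ : ∀ a q r → map (a *_) q *ₚ r ≋ map (a *_) (q *ₚ r)
    scale-*ₚ a []      r = ≋-refl
    scale-*ₚ a (b ∷ q) r = coeffwise λ k → begin
      coeff ((a * b ∷ map (a *_) q) *ₚ r) k
        ≡⟨ coeff-∷ₚ-*ₚ (a * b) (map (a *_) q) r k ⟩
      a * b * coeff r k + coeff (+ 0 ∷ map (a *_) q *ₚ r) k
        ≡⟨ cong (_+_ (a * b * coeff r k)) (coeff-≡ (∷-cong (sym (ℤ.*-zeroʳ a)) (scale-*ₚ a q r)) k) ⟩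
      a * b * coeff r k + coeff (map (a *_) (+ 0 ∷ q *ₚ r)) k
        ≡⟨ cong (_+_ (a * b * coeff r k)) (coeff-scale a (+ 0 ∷ q *ₚ r) k) ⟩
      a * b * coeff r k + a * coeff (+ 0 ∷ q *ₚ r) k
        ≡⟨ solve 4 (λ a b c x → a :* b :* c :+ a :* x := a :* (b :* c :+ x)) refl a b (coeff r k) _ ⟩
      a * (b * coeff r k + coeff (+ 0 ∷ q *ₚ r) k)
        ≡⟨ cong (a *_) (coeff-∷ₚ-*ₚ b q r k) ⟨
      a * coeff ((b ∷ q) *ₚ r) k
        ≡⟨ coeff-scale a ((b ∷ q) *ₚ r) k ⟨
      coeff (map (a *_) ((b ∷ q) *ₚ r)) k
        ∎

    shift-*ₚ : ∀ p r → (+ 0 ∷ p) *ₚ r ≋ + 0 ∷ p *ₚ r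
    shift-*ₚ p r = coeffwise λ k → trans (coeff-∷ₚ-*ₚ (+ 0) p r k) (ℤ.+-identityˡ _)

    *ₚ-assoc : ∀ p q r → (p *ₚ q) *ₚ r ≋ p *ₚ (q *ₚ r)
    *ₚ-assoc []      q r = ≋-refl
    *ₚ-assoc (a ∷ p) q r =
      ≋-trans (*ₚ-distribʳ r (map (a *_) q) (+ 0 ∷ p *ₚ q))
              (+ₚ-cong (scale-*ₚ a q r) (≋-trans (shift-*ₚ (p *ₚ q) r) (∷-cong refl (*ₚ-assoc p q r))))

    *ₚ-identityˡ : ∀ p → oneₚ *ₚ p ≋ p
    *ₚ-identityˡ p = coeffwise λ k → begin
      coeff (oneₚ *ₚ p) k                   ≡⟨ coeff-∷ₚ-*ₚ (+ 1) [] p k ⟩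
      + 1 * coeff p k + coeff (+ 0 ∷ []) k  ≡⟨ cong₂ _+_ (ℤ.*-identityˡ (coeff p k)) (lemma k) ⟩
      coeff p k + + 0                       ≡⟨ ℤ.+-identityʳ (coeff p k) ⟩
      coeff p k                             ∎
      where
      lemma : ∀ k → coeff (+ 0 ∷ []) k ≡ + 0
      lemma zero    = refl
      lemma (suc k) = refl

  ℤ[x] : CommutativeRing 0ℓ 0ℓ
  ℤ[x] = record { isCommutativeRing = isCommutativeRing }
    where
    isCommutativeRing : IsCommutativeRing _≋_ _+ₚ_ _*ₚ_ -ₚ_ [] oneₚ
    isCommutativeRing = record
      { isRing = record
        { +-isAbelianGroup = record
          { isGroup = record
            { isMonoid = record
              { isSemigroup = record
                { isMagma = record
                  { isEquivalence = record { refl = ≋-refl ; sym = ≋-sym ; trans = ≋-trans }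
                  ; ∙-cong = +ₚ-cong }
                ; assoc = +ₚ-assoc }
              ; identity = (λ _ → ≋-refl) , +ₚ-identityʳ }
            ; inverse = -ₚ-inverseˡ , λ p → ≋-trans (+ₚ-comm p (-ₚ p)) (-ₚ-inverseˡ p)
            ; ⁻¹-cong = -ₚ-cong }
          ; comm = +ₚ-comm }
        ; *-cong = λ {p} {p′} {q} {q′} p≋p′ q≋q′ → ≋-trans (*ₚ-congʳ q p≋p′) (*ₚ-congˡ p′ q≋q′)
        ; *-assoc = *ₚ-assoc
        ; *-identity = *ₚ-identityˡ , λ p → ≋-trans (*ₚ-comm p oneₚ) (*ₚ-identityˡ p)
        ; distrib = (λ p q r → ≋-trans (*ₚ-comm p (q +ₚ r))
                                 (≋-trans (*ₚ-distribʳ p q r) (+ₚ-cong (*ₚ-comm q p) (*ₚ-comm r p))))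
                  , *ₚ-distribʳ }
      ; *-comm = *ₚ-comm }

module Polynomials where
  open PolynomialRing
  open import Algebra.Bundles using (CommutativeRing)
  open import Data.Nat as ℕ using (ℕ; zero; suc)
  import Data.Nat.Properties as ℕ
  open import Data.Integer as ℤ using (ℤ; +_; -_)
  import Data.Integer.Properties as ℤ
  open import Data.Integer.Solver using (module +-*-Solver)
  open import Data.List using ([]; _∷_; map)
  open import Relation.Nullary using (yes; no)
  open import Relation.Binary.PropositionalEquality as ≡ using (_≡_; refl; sym; trans; cong; cong₂)
  open import Data.Maybe using (Maybe; just; nothing)
  import Algebra.Solver.Ring.AlmostCommutativeRing as ACR
  import Algebra.Solver.Ring as RingSolver
  import Relation.Binary.Reasoning.Setoid as SetoidReasoning

  open CommutativeRing ℤ[x] public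
    using (setoid; +-cong; *-cong; *-assoc; *-comm;
           *-identityˡ; *-identityʳ; distribˡ; distribʳ; zeroʳ; -‿inverseʳ; semiring; *-commutativeMonoid)
  module ≈-Reasoning = SetoidReasoning setoid
  open import Algebra.Properties.Semiring.Exp semiring using (_^_; ^-homo-*)
  open import Algebra.Properties.CommutativeSemigroup (CommutativeRing.*-commutativeSemigroup ℤ[x]) public
    using (x∙yz≈y∙xz) renaming (interchange to *-interchange)
  open import Algebra.Properties.Ring (CommutativeRing.ring ℤ[x]) public
    using (x[y-z]≈xy-xz; x∙y⁻¹≈ε⇒x≈y; x≈y⇒x∙y⁻¹≈ε; -‿involutive; -‿distribˡ-*)

  cst : ℤ → Poly
  cst a = a ∷ []

  cst-* : ∀ a b → cst (+ a) *ₚ cst (+ b) ≋ cst (+ (a ℕ.* b))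
  cst-* a b = coeffwise λ { zero → trans (ℤ.+-identityʳ _) (sym (ℤ.pos-* a b)) ; (suc k) → refl }

  module ℤ[x]-Solver where
    private
      cst-homomorphism : ℤ.+-*-rawRing ACR.-Raw-AlmostCommutative⟶ ACR.fromCommutativeRing ℤ[x]
      cst-homomorphism = record
        { ⟦_⟧    = cst
        ; +-homo = λ _ _ → ≋-refl
        ; *-homo = λ a b → coeffwise λ { zero → sym (ℤ.+-identityʳ (a ℤ.* b)) ; (suc k) → refl }
        ; -‿homo = λ _ → ≋-refl
        ; 0-homo = coeffwise λ { zero → refl ; (suc k) → refl }
        ; 1-homo = ≋-refl }

      cst≟ : ∀ a b → Maybe (cst a ≋ cst b)
      cst≟ a b with a ℤ.≟ b
      ... | yes refl = just ≋-refl
      ... | no  _    = nothing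

    open RingSolver ℤ.+-*-rawRing (ACR.fromCommutativeRing ℤ[x]) cst-homomorphism cst≟ public


  ^ₚ≡^ : ∀ p e → p ^ₚ e ≡ p ^ e
  ^ₚ≡^ p zero    = refl
  ^ₚ≡^ p (suc e) = cong (p *ₚ_) (^ₚ≡^ p e)

  ^ₚ-+ : ∀ p a b → p ^ₚ (a ℕ.+ b) ≋ p ^ₚ a *ₚ p ^ₚ b
  ^ₚ-+ p a b rewrite ^ₚ≡^ p (a ℕ.+ b) | ^ₚ≡^ p a | ^ₚ≡^ p b = ^-homo-* p a b

  module _ where
    open import Data.Integer.Base using (_+_; _*_)
    open +-*-Solver
    open ≡.≡-Reasoning

    eval-+ₚ : ∀ p q x → eval (p +ₚ q) x ≡ eval p x + eval q x
    eval-+ₚ []      q       x = sym (ℤ.+-identityˡ _)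
    eval-+ₚ (a ∷ p) []      x = sym (ℤ.+-identityʳ _)
    eval-+ₚ (a ∷ p) (b ∷ q) x = begin
      a + b + x * eval (p +ₚ q) x
        ≡⟨ cong (λ t → a + b + x * t) (eval-+ₚ p q x) ⟩
      a + b + x * (eval p x + eval q x)
        ≡⟨ solve 5 (λ a b x u v → a :+ b :+ x :* (u :+ v) := (a :+ x :* u) :+ (b :+ x :* v)) refl a b x _ _ ⟩
      (a + x * eval p x) + (b + x * eval q x) ∎

    eval-scale : ∀ c p x → eval (map (c *_) p) x ≡ c * eval p x
    eval-scale c []      x = sym (ℤ.*-zeroʳ c)
    eval-scale c (a ∷ p) x = begin
      c * a + x * eval (map (c *_) p) x ≡⟨ cong (λ t → c * a + x * t) (eval-scale c p x) ⟩
      c * a + x * (c * eval p x)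
        ≡⟨ solve 4 (λ c a x u → c :* a :+ x :* (c :* u) := c :* (a :+ x :* u)) refl c a x _ ⟩
      c * (a + x * eval p x)             ∎

    eval-*ₚ : ∀ p q x → eval (p *ₚ q) x ≡ eval p x * eval q x
    eval-*ₚ []      q x = refl
    eval-*ₚ (a ∷ p) q x = begin
      eval (map (a *_) q +ₚ (+ 0 ∷ p *ₚ q)) x
        ≡⟨ eval-+ₚ (map (a *_) q) _ x ⟩
      eval (map (a *_) q) x + (+ 0 + x * eval (p *ₚ q) x)
        ≡⟨ cong₂ (λ u v → u + (+ 0 + x * v)) (eval-scale a q x) (eval-*ₚ p q x) ⟩
      a * eval q x + (+ 0 + x * (eval p x * eval q x))
        ≡⟨ solve 4 (λ a x u v → a :* v :+ (con (+ 0) :+ x :* (u :* v)) := (a :+ x :* u) :* v) refl a x _ _ ⟩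
      (a + x * eval p x) * eval q x ∎

    eval-≈ₚ[] : ∀ p x → p ≈ₚ [] → eval p x ≡ + 0
    eval-≈ₚ[] []      x p≈0 = refl
    eval-≈ₚ[] (a ∷ p) x p≈0 =
      trans (cong₂ (λ u v → u + x * v) (p≈0 zero) (eval-≈ₚ[] p x (λ k → p≈0 (suc k)))) (cong (_+_ (+ 0)) (ℤ.*-zeroʳ x))

    eval-cong : ∀ {p q} x → p ≋ q → eval p x ≡ eval q x
    eval-cong {[]}    {q}     x (coeffwise e) = sym (eval-≈ₚ[] q x (λ k → sym (e k)))
    eval-cong {a ∷ p} {[]}    x (coeffwise e) = eval-≈ₚ[] (a ∷ p) x e
    eval-cong {a ∷ p} {b ∷ q} x (coeffwise e) =
      cong₂ (λ u v → u + x * v) (e zero) (eval-cong {p} {q} x (coeffwise λ k → e (suc k)))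

    eval-*ₚ-zeroˡ : ∀ p q {x} → eval p x ≡ + 0 → eval (p *ₚ q) x ≡ + 0
    eval-*ₚ-zeroˡ p q {x} p≡0 = trans (eval-*ₚ p q x) (trans (cong (_* eval q x) p≡0) (ℤ.*-zeroˡ (eval q x)))

    eval-*ₚ-zeroʳ : ∀ p q {x} → eval q x ≡ + 0 → eval (p *ₚ q) x ≡ + 0
    eval-*ₚ-zeroʳ p q {x} q≡0 = trans (eval-*ₚ p q x) (trans (cong (eval p x *_) q≡0) (ℤ.*-zeroʳ (eval p x)))

    eval-cst : ∀ a x → eval (cst a) x ≡ a
    eval-cst a x = trans (cong (_+_ a) (ℤ.*-zeroʳ x)) (ℤ.+-identityʳ a)

module LeadingCoefficients where
  open PolynomialRing
  open Polynomials
  open import Data.Nat as ℕ using (ℕ; zero; suc; _<_; z≤n; s≤s)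
  import Data.Nat.Properties as ℕ
  open import Data.Integer as ℤ using (ℤ; +_)
  import Data.Integer.Properties as ℤ
  open import Data.List using ([]; _∷_)
  open import Data.Product using (∃; _×_; _,_; proj₁)
  open import Data.Sum using (_⊎_; inj₁; inj₂; [_,_]′)
  open import Data.Empty using (⊥-elim)
  open import Relation.Nullary using (yes; no)
  open import Relation.Binary.Definitions using (tri<; tri≈; tri>)
  open import Relation.Binary.PropositionalEquality as ≡ using (_≡_; _≢_; refl; sym; trans; cong; cong₂; subst)

  record Leading (p : Poly) (d : ℕ) (a : ℤ) : Set where
    field
      coeff-at    : coeff p d ≡ a
      coeff-above : ∀ k → d < k → coeff p k ≡ + 0
  open Leading

  leading-cong : ∀ {p q d a} → p ≋ q → Leading p d a → Leading q d a
  leading-cong (coeffwise e) l = record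
    { coeff-at    = trans (sym (e _)) (coeff-at l)
    ; coeff-above = λ k d<k → trans (sym (e k)) (coeff-above l k d<k) }

  module _ where
    open import Data.Integer.Base using (_+_; _*_)

    private
      coeff-shift-≈[] : ∀ {r} → r ≋ [] → ∀ k → coeff (+ 0 ∷ r) k ≡ + 0
      coeff-shift-≈[] r≋0 zero    = refl
      coeff-shift-≈[] r≋0 (suc k) = coeff-≡ r≋0 k

      c*0+t≡t : ∀ c t → c * + 0 + t ≡ t
      c*0+t≡t c t = trans (cong (_+ t) (ℤ.*-zeroʳ c)) (ℤ.+-identityˡ t)

    leading-*ₚ : ∀ {p q d e a b} → Leading p d a → Leading q e b → Leading (p *ₚ q) (d ℕ.+ e) (a * b)
    leading-*ₚ {[]} {b = b} lp lq = record
      { coeff-at    = trans (sym (ℤ.*-zeroˡ b)) (cong (_* b) (coeff-at lp))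
      ; coeff-above = λ _ _ → refl }
    leading-*ₚ {c ∷ p} {q} {zero} {e} {a} {b} lp lq = record
      { coeff-at    = begin
          coeff ((c ∷ p) *ₚ q) e                  ≡⟨ coeff-∷ₚ-*ₚ c p q e ⟩
          c * coeff q e + coeff (+ 0 ∷ p *ₚ q) e
            ≡⟨ cong₂ (λ u v → u * v + coeff (+ 0 ∷ p *ₚ q) e) (coeff-at lp) (coeff-at lq) ⟩
          a * b + coeff (+ 0 ∷ p *ₚ q) e          ≡⟨ cong (_+_ (a * b)) (coeff-shift-≈[] p*q≋0 e) ⟩
          a * b + + 0                             ≡⟨ ℤ.+-identityʳ (a * b) ⟩
          a * b                                   ∎
      ; coeff-above = λ k e<k → begin
          coeff ((c ∷ p) *ₚ q) k                  ≡⟨ coeff-∷ₚ-*ₚ c p q k ⟩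
          c * coeff q k + coeff (+ 0 ∷ p *ₚ q) k
            ≡⟨ cong₂ (λ u v → c * u + v) (coeff-above lq k e<k) (coeff-shift-≈[] p*q≋0 k) ⟩
          c * + 0 + + 0                           ≡⟨ c*0+t≡t c (+ 0) ⟩
          + 0                                     ∎ }
      where
      open ≡.≡-Reasoning
      p*q≋0 : p *ₚ q ≋ []
      p*q≋0 = *ₚ-congʳ {p} {[]} q (coeffwise λ k → coeff-above lp (suc k) (s≤s z≤n))
    leading-*ₚ {c ∷ p} {q} {suc d} {e} {a} {b} lp lq = record
      { coeff-at    = trans (coeff-∷ₚ-*ₚ c p q (suc (d ℕ.+ e)))
                        (trans (cong (λ u → c * u + coeff (p *ₚ q) (d ℕ.+ e)) (coeff-above lq _ (s≤s (ℕ.m≤n+m e d))))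
                          (trans (c*0+t≡t c _) (coeff-at ih)))
      ; coeff-above = λ { (suc k) (s≤s d+e<k) →
          trans (coeff-∷ₚ-*ₚ c p q (suc k))
            (trans (cong (λ u → c * u + coeff (p *ₚ q) k) (coeff-above lq _ (s≤s (ℕ.≤-trans (ℕ.m≤n+m e d) (ℕ.<⇒≤ d+e<k)))))
              (trans (c*0+t≡t c _) (coeff-above ih k d+e<k))) } }
      where
      ih : Leading (p *ₚ q) (d ℕ.+ e) (a * b)
      ih = leading-*ₚ {p} (record { coeff-at = coeff-at lp ; coeff-above = λ k d<k → coeff-above lp (suc k) (s≤s d<k) }) lq

  leading-exists : ∀ p → p ≋ [] ⊎ ∃ λ d → ∃ λ a → a ≢ + 0 × Leading p d a
  leading-exists []      = inj₁ ≋-refl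
  leading-exists (c ∷ p) with leading-exists p
  ... | inj₂ (d , a , a≢0 , l) = inj₂ (suc d , a , a≢0 , record
          { coeff-at = coeff-at l ; coeff-above = λ { (suc k) (s≤s d<k) → coeff-above l k d<k } })
  ... | inj₁ p≋0 with c ℤ.≟ + 0
  ...   | yes c≡0 = inj₁ (coeffwise λ { zero → c≡0 ; (suc k) → coeff-≡ p≋0 k })
  ...   | no  c≢0 = inj₂ (0 , c , c≢0 , record
          { coeff-at = refl ; coeff-above = λ { (suc k) _ → coeff-≡ p≋0 k } })

  leading-unique : ∀ {p d e a b} → a ≢ + 0 → b ≢ + 0 → Leading p d a → Leading p e b → d ≡ e × a ≡ b
  leading-unique {d = d} {e} a≢0 b≢0 lp lq with ℕ.<-cmp d e
  ... | tri< d<e _ _ = ⊥-elim (b≢0 (trans (sym (coeff-at lq)) (coeff-above lp e d<e)))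
  ... | tri≈ _ refl _ = refl , trans (sym (coeff-at lp)) (coeff-at lq)
  ... | tri> _ _ e<d = ⊥-elim (a≢0 (trans (sym (coeff-at lp)) (coeff-above lq d e<d)))

  Monic : Poly → Set
  Monic p = ∃ λ d → Leading p d (+ 1)

  monic-oneₚ : Monic oneₚ
  monic-oneₚ = 0 , record { coeff-at = refl ; coeff-above = λ { (suc k) _ → refl } }

  monic-*ₚ : ∀ {p q} → Monic p → Monic q → Monic (p *ₚ q)
  monic-*ₚ (d , lp) (e , lq) = d ℕ.+ e , leading-*ₚ lp lq

  monic-^ₚ : ∀ {p} e → Monic p → Monic (p ^ₚ e)
  monic-^ₚ zero    _  = monic-oneₚ
  monic-^ₚ (suc e) mp = monic-*ₚ mp (monic-^ₚ e mp)

  monic-1+xPow : ∀ i → Monic (oneₚ +ₚ xPow (suc i))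
  monic-1+xPow i = suc i , record
    { coeff-at    = coeff-xPow i
    ; coeff-above = λ { (suc k) (s≤s i<k) → coeff-xPow-above i k i<k } }
    where
    coeff-xPow : ∀ i → coeff (xPow i) i ≡ + 1
    coeff-xPow zero    = refl
    coeff-xPow (suc i) = coeff-xPow i

    coeff-xPow-above : ∀ i k → i < k → coeff (xPow i) k ≡ + 0
    coeff-xPow-above zero    (suc k) _         = refl
    coeff-xPow-above (suc i) (suc k) (s≤s i<k) = coeff-xPow-above i k i<k

  monic-cancelˡ : ∀ {p q r} → Monic p → p *ₚ q ≋ p *ₚ r → q ≋ r
  monic-cancelˡ {p} {q} {r} (d , lp) pq≋pr with leading-exists (q +ₚ -ₚ r)
  ... | inj₁ q-r≋0 = x∙y⁻¹≈ε⇒x≈y q r q-r≋0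
  ... | inj₂ (e , b , b≢0 , l) =
    ⊥-elim (b≢0 (trans (sym (trans (coeff-at (leading-*ₚ lp l)) (ℤ.*-identityˡ b))) (coeff-≡ p[q-r]≋0 (d ℕ.+ e))))
    where
    p[q-r]≋0 : p *ₚ (q +ₚ -ₚ r) ≋ []
    p[q-r]≋0 = ≋-trans (x[y-z]≈xy-xz p q r) (x≈y⇒x∙y⁻¹≈ε pq≋pr)

  leading-cst : ∀ a → Leading (cst a) 0 a
  leading-cst a = record { coeff-at = refl ; coeff-above = λ { (suc k) _ → refl } }

  *ₚ≈cst⇒cst : ∀ {p q c} → c ≢ + 0 → p *ₚ q ≋ cst c → ∃ λ b → b ≢ + 0 × p ≋ cst b
  *ₚ≈cst⇒cst {p} {q} {c} c≢0 pq≋c with leading-exists p | leading-exists q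
  ... | inj₁ p≋0 | _ = ⊥-elim (c≢0 (trans (sym (coeff-≡ pq≋c 0)) (coeff-≡ (*ₚ-congʳ q p≋0) 0)))
  ... | inj₂ _ | inj₁ q≋0 = ⊥-elim (c≢0 (trans (sym (coeff-≡ pq≋c 0)) (coeff-≡ (≋-trans (*ₚ-congˡ p q≋0) (*ₚ-zeroʳ p)) 0)))
  ... | inj₂ (d , a , a≢0 , lp) | inj₂ (e , b , b≢0 , lq) = a , a≢0 , coeffwise λ
    { zero    → subst (λ i → coeff p i ≡ a) d≡0 (coeff-at lp)
    ; (suc k) → coeff-above lp (suc k) (subst (_< suc k) (sym d≡0) (s≤s z≤n)) }
    where
    ab≢0 : a ℤ.* b ≢ + 0
    ab≢0 ab≡0 = [ a≢0 , b≢0 ]′ (ℤ.i*j≡0⇒i≡0∨j≡0 a ab≡0)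
    d≡0 : d ≡ 0
    d≡0 = ℕ.m+n≡0⇒m≡0 d (sym (proj₁ (leading-unique c≢0 ab≢0 (leading-cst c) (leading-cong pq≋c (leading-*ₚ lp lq)))))

module GeometricSums where
  open PolynomialRing
  open Polynomials
  open OddParts using (odd-*)
  open import Data.Nat as ℕ using (ℕ; zero; suc)
  import Data.Nat.Properties as ℕ
  open import Data.Nat.GCD using (module Bézout)
  open import Data.Integer as ℤ using (ℤ; +_; -_)
  import Data.Integer.Properties as ℤ
  open import Data.List using ([]; _∷_)
  open import Data.Product using (∃; ∃₂; _,_)
  open import Relation.Binary.PropositionalEquality as ≡ using (_≡_; refl; sym; trans; cong; cong₂; subst)
  open ℤ[x]-Solver using (solve; _:=_; _:+_; _:*_; :-_; _:-_; con)

  infix 25 1+x^_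
  1+x^_ : ℕ → Poly
  1+x^ i = oneₚ +ₚ xPow i

  -x : Poly
  -x = -ₚ xPow 1

  geom : Poly → ℕ → Poly
  geom z zero    = []
  geom z (suc r) = oneₚ +ₚ z *ₚ geom z r

  ψ : ℕ → Poly
  ψ = geom -x

  geom-telescope : ∀ z r → (oneₚ +ₚ -ₚ z) *ₚ geom z r ≋ oneₚ +ₚ -ₚ (z ^ₚ r)
  geom-telescope z zero    = ≋-trans (zeroʳ (oneₚ +ₚ -ₚ z)) (≋-sym (-‿inverseʳ oneₚ))
  geom-telescope z (suc r) = begin
    (oneₚ +ₚ -ₚ z) *ₚ (oneₚ +ₚ z *ₚ geom z r)
      ≈⟨ solve 2 (λ z g → (con (+ 1) :- z) :* (con (+ 1) :+ z :* g)
                        := (con (+ 1) :- z) :+ z :* ((con (+ 1) :- z) :* g)) ≋-refl z (geom z r) ⟩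
    (oneₚ +ₚ -ₚ z) +ₚ z *ₚ ((oneₚ +ₚ -ₚ z) *ₚ geom z r)
      ≈⟨ +ₚ-congˡ (oneₚ +ₚ -ₚ z) (*ₚ-congˡ z (geom-telescope z r)) ⟩
    (oneₚ +ₚ -ₚ z) +ₚ z *ₚ (oneₚ +ₚ -ₚ (z ^ₚ r))
      ≈⟨ solve 2 (λ z w → (con (+ 1) :- z) :+ z :* (con (+ 1) :- w) := con (+ 1) :- z :* w) ≋-refl z (z ^ₚ r) ⟩
    oneₚ +ₚ -ₚ (z *ₚ z ^ₚ r) ∎
    where
    open ≈-Reasoning

  geom-+ : ∀ z a b → geom z (a ℕ.+ b) ≋ geom z a +ₚ z ^ₚ a *ₚ geom z b
  geom-+ z zero    b = ≋-sym (*-identityˡ (geom z b))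
  geom-+ z (suc a) b = begin
    oneₚ +ₚ z *ₚ geom z (a ℕ.+ b)
      ≈⟨ +ₚ-congˡ oneₚ (*ₚ-congˡ z (geom-+ z a b)) ⟩
    oneₚ +ₚ z *ₚ (geom z a +ₚ z ^ₚ a *ₚ geom z b)
      ≈⟨ solve 4 (λ z g w h → con (+ 1) :+ z :* (g :+ w :* h) := (con (+ 1) :+ z :* g) :+ (z :* w) :* h)
                 ≋-refl z (geom z a) (z ^ₚ a) (geom z b) ⟩
    (oneₚ +ₚ z *ₚ geom z a) +ₚ (z *ₚ z ^ₚ a) *ₚ geom z b ∎
    where open ≈-Reasoning

  geom-* : ∀ z a b → geom z (a ℕ.* b) ≋ geom z a *ₚ geom (z ^ₚ a) b
  geom-* z a zero    rewrite ℕ.*-zeroʳ a = ≋-sym (*ₚ-zeroʳ (geom z a))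
  geom-* z a (suc b) rewrite ℕ.*-suc a b = begin
    geom z (a ℕ.+ a ℕ.* b)
      ≈⟨ geom-+ z a (a ℕ.* b) ⟩
    geom z a +ₚ z ^ₚ a *ₚ geom z (a ℕ.* b)
      ≈⟨ +ₚ-congˡ (geom z a) (*ₚ-congˡ (z ^ₚ a) (geom-* z a b)) ⟩
    geom z a +ₚ z ^ₚ a *ₚ (geom z a *ₚ geom (z ^ₚ a) b)
      ≈⟨ solve 3 (λ g w h → g :+ w :* (g :* h) := g :* (con (+ 1) :+ w :* h)) ≋-refl (geom z a) (z ^ₚ a) (geom (z ^ₚ a) b) ⟩
    geom z a *ₚ (oneₚ +ₚ z ^ₚ a *ₚ geom (z ^ₚ a) b) ∎
    where open ≈-Reasoning

  geom-cong : ∀ {z z′} r → z ≋ z′ → geom z r ≋ geom z′ r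
  geom-cong zero    z≋z′ = ≋-refl
  geom-cong (suc r) z≋z′ = +ₚ-congˡ oneₚ (*-cong z≋z′ (geom-cong r z≋z′))

  infix 4 _∈⟨_,_⟩
  _∈⟨_,_⟩ : Poly → Poly → Poly → Set
  c ∈⟨ a , b ⟩ = ∃₂ λ U V → U *ₚ a +ₚ V *ₚ b ≋ c

  geom-mod : ∀ z r → ∃ λ W → geom z r ≋ cst (+ r) +ₚ (oneₚ +ₚ -ₚ z) *ₚ W
  geom-mod z zero    = [] ,
    ≋-sym (≋-trans (+ₚ-congˡ (cst (+ 0)) (*ₚ-zeroʳ (oneₚ +ₚ -ₚ z))) (coeffwise λ { zero → refl ; (suc k) → refl }))
  geom-mod z (suc r) with geom-mod z r
  ... | W , g≋r+[1-z]W = z *ₚ W +ₚ -ₚ cst (+ r) , (begin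
    oneₚ +ₚ z *ₚ geom z r
      ≈⟨ +ₚ-congˡ oneₚ (*ₚ-congˡ z g≋r+[1-z]W) ⟩
    oneₚ +ₚ z *ₚ (cst (+ r) +ₚ (oneₚ +ₚ -ₚ z) *ₚ W)
      ≈⟨ solve 3 (λ z W R → con (+ 1) :+ z :* (R :+ (con (+ 1) :- z) :* W)
                          := (con (+ 1) :+ R) :+ (con (+ 1) :- z) :* (z :* W :- R)) ≋-refl z W (cst (+ r)) ⟩
    cst (+ suc r) +ₚ (oneₚ +ₚ -ₚ z) *ₚ (z *ₚ W +ₚ -ₚ cst (+ r)) ∎)
    where open ≈-Reasoning

  xPow-suc : ∀ a → xPow (suc a) ≋ xPow 1 *ₚ xPow a
  xPow-suc a = ≋-sym (≋-trans (shift-*ₚ oneₚ (xPow a)) (∷-cong refl (*ₚ-identityˡ (xPow a))))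

  -x^-odd : ∀ {a} → Odd a → -x ^ₚ a ≋ -ₚ xPow a
  -x^-odd (k , refl) = go k
    where
    go : ∀ k → -x ^ₚ suc (2 ℕ.* k) ≋ -ₚ xPow (suc (2 ℕ.* k))
    go zero = *-identityʳ -x
    go (suc k) = subst (λ t → -x ^ₚ t ≋ -ₚ xPow t) (cong suc (sym (ℕ.*-suc 2 k))) (begin
      -x *ₚ (-x *ₚ -x ^ₚ m)
        ≈⟨ *ₚ-congˡ -x (*ₚ-congˡ -x (go k)) ⟩
      -x *ₚ (-x *ₚ -ₚ xPow m)
        ≈⟨ solve 2 (λ X P → (:- X) :* ((:- X) :* (:- P)) := :- (X :* (X :* P))) ≋-refl (xPow 1) (xPow m) ⟩
      -ₚ (xPow 1 *ₚ (xPow 1 *ₚ xPow m))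
        ≈⟨ -ₚ-cong (≋-sym (≋-trans (xPow-suc (suc m)) (*ₚ-congˡ (xPow 1) (xPow-suc m)))) ⟩
      -ₚ xPow (suc (suc m)) ∎)
      where
      open ≈-Reasoning
      m = suc (2 ℕ.* k)

  1-−x≋1+x : oneₚ +ₚ -ₚ -x ≋ 1+x^ 1
  1-−x≋1+x = +ₚ-congˡ oneₚ (-‿involutive (xPow 1))

  1+x^-factor : ∀ {a} → Odd a → 1+x^ a ≋ 1+x^ 1 *ₚ ψ a
  1+x^-factor {a} odd = begin
    oneₚ +ₚ xPow a
      ≈⟨ +ₚ-congˡ oneₚ (≋-trans (≋-sym (-‿involutive (xPow a))) (-ₚ-cong (≋-sym (-x^-odd odd)))) ⟩
    oneₚ +ₚ -ₚ (-x ^ₚ a)             ≈⟨ geom-telescope -x a ⟨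
    (oneₚ +ₚ -ₚ -x) *ₚ ψ a           ≈⟨ *ₚ-congʳ (ψ a) 1-−x≋1+x ⟩
    1+x^ 1 *ₚ ψ a                    ∎
    where open ≈-Reasoning

  1+x^-* : ∀ {a b} → Odd a → Odd b → 1+x^ (a ℕ.* b) ≋ 1+x^ a *ₚ geom (-x ^ₚ a) b
  1+x^-* {a} {b} odd-a odd-b = begin
    1+x^ (a ℕ.* b)
      ≈⟨ 1+x^-factor (odd-* odd-a odd-b) ⟩
    1+x^ 1 *ₚ ψ (a ℕ.* b)
      ≈⟨ *ₚ-congˡ (1+x^ 1) (geom-* -x a b) ⟩
    1+x^ 1 *ₚ (ψ a *ₚ geom (-x ^ₚ a) b)
      ≈⟨ *-assoc (1+x^ 1) (ψ a) _ ⟨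
    (1+x^ 1 *ₚ ψ a) *ₚ geom (-x ^ₚ a) b
      ≈⟨ *ₚ-congʳ (geom (-x ^ₚ a) b) (1+x^-factor odd-a) ⟨
    1+x^ a *ₚ geom (-x ^ₚ a) b ∎
    where open ≈-Reasoning

  ψ-multiple : ∀ m q → ψ (q ℕ.* m) ≋ geom (-x ^ₚ m) q *ₚ ψ m
  ψ-multiple m q = ≋-trans (≋-reflexive (cong ψ (ℕ.*-comm q m))) (≋-trans (geom-* -x m q) (*-comm (ψ m) _))

  ψ-+-cancel : ∀ d t {s} → d ℕ.+ t ≡ s → ψ s +ₚ -ₚ (-x ^ₚ d *ₚ ψ t) ≋ ψ d
  ψ-+-cancel d t refl = begin
    ψ (d ℕ.+ t) +ₚ -ₚ (-x ^ₚ d *ₚ ψ t)                   ≈⟨ +ₚ-congʳ _ (geom-+ -x d t) ⟩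
    (ψ d +ₚ -x ^ₚ d *ₚ ψ t) +ₚ -ₚ (-x ^ₚ d *ₚ ψ t)
      ≈⟨ solve 2 (λ a b → (a :+ b) :- b := a) ≋-refl (ψ d) (-x ^ₚ d *ₚ ψ t) ⟩
    ψ d                                                 ∎
    where open ≈-Reasoning

  ψ-bézout : ∀ {d m n} → Bézout.Identity d m n → ψ d ∈⟨ ψ m , ψ n ⟩
  ψ-bézout {d} {m} {n} (Bézout.+- x y d+yn≡xm) = U , V , (begin
    U *ₚ ψ m +ₚ V *ₚ ψ n
      ≈⟨ +ₚ-congˡ (U *ₚ ψ m) (≋-trans (≋-sym (-‿distribˡ-* (w *ₚ G) (ψ n))) (-ₚ-cong (*-assoc w G (ψ n)))) ⟩
    U *ₚ ψ m +ₚ -ₚ (-x ^ₚ d *ₚ (geom (-x ^ₚ n) y *ₚ ψ n))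
      ≈⟨ +-cong (≋-sym (ψ-multiple m x)) (-ₚ-cong (*ₚ-congˡ (-x ^ₚ d) (≋-sym (ψ-multiple n y)))) ⟩
    ψ (x ℕ.* m) +ₚ -ₚ (-x ^ₚ d *ₚ ψ (y ℕ.* n))
      ≈⟨ ψ-+-cancel d (y ℕ.* n) d+yn≡xm ⟩
    ψ d ∎)
    where
    open ≈-Reasoning
    w = -x ^ₚ d
    G = geom (-x ^ₚ n) y
    U = geom (-x ^ₚ m) x
    V = -ₚ (w *ₚ G)
  ψ-bézout {d} {m} {n} (Bézout.-+ x y d+xm≡yn) with ψ-bézout {d} {n} {m} (Bézout.+- y x d+xm≡yn)
  ... | V , U , Vψn+Uψm≋ψd = U , V , ≋-trans (+ₚ-comm (U *ₚ ψ m) (V *ₚ ψ n)) Vψn+Uψm≋ψd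

  eval-geom : ∀ z r {x} → eval z x ≡ + 1 → eval (geom z r) x ≡ + r
  eval-geom z zero    z≡1 = refl
  eval-geom z (suc r) {x} z≡1 = begin
    eval (oneₚ +ₚ z *ₚ geom z r) x
      ≡⟨ eval-+ₚ oneₚ (z *ₚ geom z r) x ⟩
    eval oneₚ x ℤ.+ eval (z *ₚ geom z r) x
      ≡⟨ cong₂ ℤ._+_ (eval-cst (+ 1) x) (eval-*ₚ z (geom z r) x) ⟩
    + 1 ℤ.+ eval z x ℤ.* eval (geom z r) x
      ≡⟨ cong₂ (λ u v → + 1 ℤ.+ u ℤ.* v) z≡1 (eval-geom z r {x} z≡1) ⟩
    + 1 ℤ.+ + 1 ℤ.* + r
      ≡⟨ cong (ℤ._+_ (+ 1)) (ℤ.*-identityˡ (+ r)) ⟩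
    + suc r ∎
    where open ≡.≡-Reasoning

  eval-ψ-at-−1 : ∀ a → eval (ψ a) (- + 1) ≡ + a
  eval-ψ-at-−1 a = eval-geom -x a {x = - + 1} refl

  eval-ψ-at-0 : ∀ r → eval (ψ (suc r)) (+ 0) ≡ + 1
  eval-ψ-at-0 r = trans (eval-+ₚ oneₚ (-x *ₚ ψ r) (+ 0)) (cong (ℤ._+_ (+ 1)) (eval-*ₚ -x (ψ r) (+ 0)))

  eval-1+x^-odd : ∀ {a} → Odd a → eval (1+x^ a) (- + 1) ≡ + 0
  eval-1+x^-odd {a} odd = trans (eval-cong (- + 1) (1+x^-factor odd)) (eval-*ₚ (1+x^ 1) (ψ a) (- + 1))

  const∈⟨ψ,1+x⟩ : ∀ m → cst (+ m) ∈⟨ ψ m , 1+x^ 1 ⟩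
  const∈⟨ψ,1+x⟩ m with geom-mod -x m
  ... | W , ψ≋m+[1+x]W = oneₚ , -ₚ W , (begin
    oneₚ *ₚ ψ m +ₚ -ₚ W *ₚ 1+x^ 1
      ≈⟨ +-cong (*-identityˡ (ψ m)) (*ₚ-congˡ (-ₚ W) (≋-sym 1-−x≋1+x)) ⟩
    ψ m +ₚ -ₚ W *ₚ (oneₚ +ₚ -ₚ -x)
      ≈⟨ +ₚ-congʳ (-ₚ W *ₚ (oneₚ +ₚ -ₚ -x)) ψ≋m+[1+x]W ⟩
    (cst (+ m) +ₚ (oneₚ +ₚ -ₚ -x) *ₚ W) +ₚ -ₚ W *ₚ (oneₚ +ₚ -ₚ -x)
      ≈⟨ solve 3 (λ c u w → (c :+ u :* w) :+ (:- w) :* u := c) ≋-refl (cst (+ m)) (oneₚ +ₚ -ₚ -x) W ⟩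
    cst (+ m) ∎)
    where open ≈-Reasoning

  const∈⟨ψ,geom⟩ : ∀ m q → cst (+ q) ∈⟨ ψ m , geom (-x ^ₚ m) q ⟩
  const∈⟨ψ,geom⟩ m q with geom-mod (-x ^ₚ m) q
  ... | W , T≋q+[1-y]W = -ₚ ((oneₚ +ₚ -ₚ -x) *ₚ W) , oneₚ , (begin
    -ₚ (u *ₚ W) *ₚ ψ m +ₚ oneₚ *ₚ T
      ≈⟨ +ₚ-congˡ (-ₚ (u *ₚ W) *ₚ ψ m) (≋-trans (*-identityˡ T) T≋q+[1-y]W) ⟩
    -ₚ (u *ₚ W) *ₚ ψ m +ₚ (cst (+ q) +ₚ (oneₚ +ₚ -ₚ (-x ^ₚ m)) *ₚ W)
      ≈⟨ +ₚ-congˡ (-ₚ (u *ₚ W) *ₚ ψ m) (+ₚ-congˡ (cst (+ q)) (*ₚ-congʳ W (≋-sym (geom-telescope -x m)))) ⟩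
    -ₚ (u *ₚ W) *ₚ ψ m +ₚ (cst (+ q) +ₚ (u *ₚ ψ m) *ₚ W)
      ≈⟨ solve 4 (λ u w p c → (:- (u :* w)) :* p :+ (c :+ (u :* p) :* w) := c) ≋-refl u W (ψ m) (cst (+ q)) ⟩
    cst (+ q) ∎)
    where
    open ≈-Reasoning
    u = oneₚ +ₚ -ₚ -x
    T = geom (-x ^ₚ m) q

module Factorization where
  open PolynomialRing
  open Polynomials
  open LeadingCoefficients
  open RangeProducts
  open OddParts
  open Multiples
  open GeometricSums
  open import Data.Nat as ℕ using (ℕ; zero; suc; _<_; _≤_; z≤n; s≤s; _∸_)
  import Data.Nat.Properties as ℕ
  open import Data.Nat.DivMod using (_/_; m*n/n≡m; /-monoˡ-≤)
  open import Data.Nat.Divisibility as ℕ using (_∣_; _∣?_; divides)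
  open import Data.Integer as ℤ using (+_; -_)
  open import Data.List using (List; []; _∷_; _++_; map; applyUpTo)
  open import Data.Nat.ListAction using (sum)
  open import Data.List.Relation.Unary.All as All using (All; []; _∷_)
  open import Data.Product using (_×_; _,_)
  open import Function using (_∘_)
  open import Relation.Nullary using (yes; no)
  open import Relation.Binary.PropositionalEquality as ≡ using (_≡_; _≢_; refl; sym; trans; cong; subst)

  open RangeProduct *-commutativeMonoid public using (∏; InRange; ∏-cong; ∏-ε; ∏-single; ∏-+; ∏-∙; ∏-comm; ∏-preserves; ∏-shift)

  ∏-^ₚ : ∀ c e s p → ∏ (λ j → c ^ₚ e j) s p ≋ c ^ₚ ∑ e s p
  ∏-^ₚ c e s zero    = ≋-refl
  ∏-^ₚ c e s (suc p) = ≋-trans (*ₚ-congˡ (c ^ₚ e s) (∏-^ₚ c e (suc s) p)) (≋-sym (^ₚ-+ c (e s) (∑ e (suc s) p)))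

  prodₚ-applyUpTo : ∀ (g : ℕ → Poly) f n → prodₚ (map g (applyUpTo f n)) ≡ ∏ (g ∘ f) 0 n
  prodₚ-applyUpTo g f zero    = refl
  prodₚ-applyUpTo g f (suc n) = cong (g (f 0) *ₚ_) (trans (prodₚ-applyUpTo g (f ∘ suc) n) (sym (∏-shift (g ∘ f) 0 n)))

  oddPowers : ℕ → (ℕ → ℕ) → Poly
  oddPowers n e = ∏ (λ k → 1+x^ suc (2 ℕ.* k) ^ₚ e k) 0 n

  hO≡oddPowers : ∀ n λs → hO n λs ≡ oddPowers n (λ k → n / suc (2 ℕ.* k) ∸ mult λs (suc (2 ℕ.* k)))
  hO≡oddPowers n λs = prodₚ-applyUpTo _ (λ k → k) n

  oddPowers-cong : ∀ n {e e′} → (∀ {k} → k < n → e k ≡ e′ k) → oddPowers n e ≋ oddPowers n e′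
  oddPowers-cong n e≡e′ = ∏-cong 0 n λ (_ , k<n) → ≋-reflexive (cong (_ ^ₚ_) (e≡e′ k<n))

  oddPowers-+ : ∀ n e e′ → oddPowers n (λ k → e k ℕ.+ e′ k) ≋ oddPowers n e *ₚ oddPowers n e′
  oddPowers-+ n e e′ = ≋-trans (∏-cong 0 n λ {k} _ → ^ₚ-+ (1+x^ suc (2 ℕ.* k)) (e k) (e′ k)) (∏-∙ _ _ 0 n)

  oddPowers-0 : ∀ n → oddPowers n (λ _ → 0) ≋ oneₚ
  oddPowers-0 n = ∏-ε 0 n λ _ → ≋-refl

  oddPowers-single : ∀ n {p} → Odd p → p ≤ n → oddPowers n (λ k → indicator (p ℕ.≟ suc (2 ℕ.* k))) ≋ 1+x^ p
  oddPowers-single n {p} (k₀ , refl) p≤n = begin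
    oddPowers n (λ k → indicator (p ℕ.≟ suc (2 ℕ.* k)))
      ≈⟨ ∏-single 0 n k₀ (z≤n , ℕ.<-≤-trans (s≤s (ℕ.m≤m+n k₀ _)) p≤n) others ⟩
    1+x^ p ^ₚ indicator (p ℕ.≟ p)
      ≈⟨ ≋-reflexive (cong (1+x^ p ^ₚ_) (indicator-yes refl (p ℕ.≟ p))) ⟩
    1+x^ p *ₚ oneₚ                                         ≈⟨ *-identityʳ (1+x^ p) ⟩
    1+x^ p                                                 ∎
    where
    open ≈-Reasoning
    others : ∀ {k} → InRange 0 n k → k ≢ k₀ → 1+x^ suc (2 ℕ.* k) ^ₚ indicator (p ℕ.≟ suc (2 ℕ.* k)) ≋ oneₚ
    others {k} _ k≢k₀ = ≋-reflexive (cong (1+x^ suc (2 ℕ.* k) ^ₚ_)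
      (indicator-no (λ eq → k≢k₀ (sym (ℕ.*-cancelˡ-≡ k₀ k 2 (ℕ.suc-injective eq)))) (p ℕ.≟ _)))

  partFactors : List ℕ → Poly
  partFactors ps = prodₚ (map 1+x^_ ps)

  mult-∷ : ∀ p ps i → mult (p ∷ ps) i ≡ indicator (p ℕ.≟ i) ℕ.+ mult ps i
  mult-∷ p ps i with p ℕ.≟ i
  ... | yes _ = refl
  ... | no  _ = refl

  partFactors≈oddPowers : ∀ n {ps} → All (λ p → Odd p × p ≤ n) ps → partFactors ps ≋ oddPowers n (λ k → mult ps (suc (2 ℕ.* k)))
  partFactors≈oddPowers n [] = ≋-sym (oddPowers-0 n)
  partFactors≈oddPowers n {p ∷ ps} ((odd , p≤n) ∷ rest) = begin
    1+x^ p *ₚ partFactors ps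
      ≈⟨ *-cong (≋-sym (oddPowers-single n odd p≤n)) (partFactors≈oddPowers n rest) ⟩
    oddPowers n (λ k → indicator (p ℕ.≟ suc (2 ℕ.* k))) *ₚ oddPowers n (λ k → mult ps (suc (2 ℕ.* k)))
      ≈⟨ oddPowers-+ n (λ k → indicator (p ℕ.≟ suc (2 ℕ.* k))) (λ k → mult ps (suc (2 ℕ.* k))) ⟨
    oddPowers n (λ k → indicator (p ℕ.≟ suc (2 ℕ.* k)) ℕ.+ mult ps (suc (2 ℕ.* k)))
      ≈⟨ oddPowers-cong n (λ {k} _ → sym (mult-∷ p ps (suc (2 ℕ.* k)))) ⟩
    oddPowers n (λ k → mult (p ∷ ps) (suc (2 ℕ.* k))) ∎
    where open ≈-Reasoning

  mult-bound : ∀ ps i → mult ps i ℕ.* i ≤ sum ps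
  mult-bound []       i = z≤n
  mult-bound (p ∷ ps) i with p ℕ.≟ i
  ... | yes refl = ℕ.+-monoʳ-≤ p (mult-bound ps p)
  ... | no  _    = ℕ.≤-trans (mult-bound ps i) (ℕ.m≤n+m (sum ps) p)

  parts≤sum : ∀ ps → All (_≤ sum ps) ps
  parts≤sum []       = []
  parts≤sum (p ∷ ps) = ℕ.m≤m+n p (sum ps) ∷ All.map (λ q≤ → ℕ.≤-trans q≤ (ℕ.m≤n+m (sum ps) p)) (parts≤sum ps)

  hO*partFactors : ∀ n {ps} → IsOddPartition n ps → hO n ps *ₚ partFactors ps ≋ oddPowers n (λ k → n / suc (2 ℕ.* k))
  hO*partFactors n {ps} (_ , odd , refl) = begin
    hO n ps *ₚ partFactors ps
      ≈⟨ *-cong (≋-reflexive (hO≡oddPowers n ps)) (partFactors≈oddPowers n (All.zip (odd , parts≤sum ps))) ⟩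
    oddPowers n (λ k → n / suc (2 ℕ.* k) ∸ mult ps (suc (2 ℕ.* k))) *ₚ oddPowers n (λ k → mult ps (suc (2 ℕ.* k)))
      ≈⟨ oddPowers-+ n (λ k → n / suc (2 ℕ.* k) ∸ mult ps (suc (2 ℕ.* k))) (λ k → mult ps (suc (2 ℕ.* k))) ⟨
    oddPowers n (λ k → n / suc (2 ℕ.* k) ∸ mult ps (suc (2 ℕ.* k)) ℕ.+ mult ps (suc (2 ℕ.* k)))
      ≈⟨ oddPowers-cong n (λ {k} _ → ℕ.m∸n+n≡m (mult≤n/i (suc (2 ℕ.* k)))) ⟩
    oddPowers n (λ k → n / suc (2 ℕ.* k)) ∎
    where
    open ≈-Reasoning
    mult≤n/i : ∀ i .{{_ : ℕ.NonZero i}} → mult ps i ≤ n / i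
    mult≤n/i i = subst (_≤ n / i) (m*n/n≡m (mult ps i) i) (/-monoˡ-≤ i (mult-bound ps i))

  -- #{1 ≤ j ≤ n : o(j) = i}: throughout, position j stands for the integer j + 1.
  oddPartCount : ℕ → ℕ → ℕ
  oddPartCount n i = ∑ (λ j → indicator (oddPart (suc j) ℕ.≟ i)) 0 n

  ∏-1+x^oddPart : ∀ n → ∏ (λ j → 1+x^ oddPart (suc j)) 0 n ≋ oddPowers n (λ k → oddPartCount n (suc (2 ℕ.* k)))
  ∏-1+x^oddPart n = begin
    ∏ (λ j → 1+x^ oddPart (suc j)) 0 n
      ≈⟨ ∏-cong 0 n (λ {j} (_ , j<n) → ≋-sym (oddPowers-single n (oddPart-odd j) (ℕ.≤-trans (oddPart≤ j) j<n))) ⟩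
    ∏ (λ j → ∏ (λ k → 1+x^ suc (2 ℕ.* k) ^ₚ indicator (oddPart (suc j) ℕ.≟ suc (2 ℕ.* k))) 0 n) 0 n
      ≈⟨ ∏-comm (λ j k → 1+x^ suc (2 ℕ.* k) ^ₚ indicator (oddPart (suc j) ℕ.≟ suc (2 ℕ.* k))) 0 n 0 n ⟩
    ∏ (λ k → ∏ (λ j → 1+x^ suc (2 ℕ.* k) ^ₚ indicator (oddPart (suc j) ℕ.≟ suc (2 ℕ.* k))) 0 n) 0 n
      ≈⟨ ∏-cong 0 n (λ {k} _ → ∏-^ₚ (1+x^ suc (2 ℕ.* k)) (λ j → indicator (oddPart (suc j) ℕ.≟ suc (2 ℕ.* k))) 0 n) ⟩
    oddPowers n (λ k → oddPartCount n (suc (2 ℕ.* k))) ∎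
    where
    open ≈-Reasoning
    oddPart≤ : ∀ j → oddPart (suc j) ≤ suc j
    oddPart≤ j = ℕ.∣⇒≤ (oddPart∣ j)

  oddPartCount≤ : ∀ n i .{{_ : ℕ.NonZero i}} → oddPartCount n i ≤ n / i
  oddPartCount≤ n i = subst (oddPartCount n i ≤_) (count-multiples i n)
    (∑-mono-≤ (λ j → indicator-mono (λ { refl → oddPart∣ j }) (oddPart (suc j) ℕ.≟ i) (i ∣? suc j)) 0 n)

  commonFactor : ℕ → Poly
  commonFactor n = oddPowers n (λ k → n / suc (2 ℕ.* k) ∸ oddPartCount n (suc (2 ℕ.* k)))

  commonFactor*∏ : ∀ n → commonFactor n *ₚ ∏ (λ j → 1+x^ oddPart (suc j)) 0 n ≋ oddPowers n (λ k → n / suc (2 ℕ.* k))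
  commonFactor*∏ n = begin
    commonFactor n *ₚ ∏ (λ j → 1+x^ oddPart (suc j)) 0 n
      ≈⟨ *ₚ-congˡ (commonFactor n) (∏-1+x^oddPart n) ⟩
    commonFactor n *ₚ oddPowers n (λ k → c (suc (2 ℕ.* k)))
      ≈⟨ oddPowers-+ n (λ k → n / suc (2 ℕ.* k) ∸ c (suc (2 ℕ.* k))) (λ k → c (suc (2 ℕ.* k))) ⟨
    oddPowers n (λ k → n / suc (2 ℕ.* k) ∸ c (suc (2 ℕ.* k)) ℕ.+ c (suc (2 ℕ.* k)))
      ≈⟨ oddPowers-cong n (λ {k} _ → ℕ.m∸n+n≡m (oddPartCount≤ n (suc (2 ℕ.* k)))) ⟩
    oddPowers n (λ k → n / suc (2 ℕ.* k)) ∎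
    where
    open ≈-Reasoning
    c = oddPartCount n

  -- (1 + x^o(j+1)) / (1 + x^p) when p divides o(j+1), otherwise 1 + x^o(j+1).
  blockFactor : ℕ → ℕ → Poly
  blockFactor p j with p ∣? oddPart (suc j)
  ... | yes (divides q _) = geom (-x ^ₚ p) q
  ... | no  _             = 1+x^ oddPart (suc j)

  1+x^oddPart-split : ∀ {p} j → Odd p → 1+x^ oddPart (suc j) ≋ 1+x^ p ^ₚ indicator (p ∣? oddPart (suc j)) *ₚ blockFactor p j
  1+x^oddPart-split {p} j odd-p with p ∣? oddPart (suc j)
  ... | yes (divides q o≡qp) = begin
    1+x^ oddPart (suc j)                     ≡⟨ cong 1+x^_ (trans o≡qp (ℕ.*-comm q p)) ⟩
    1+x^ (p ℕ.* q)                           ≈⟨ 1+x^-* odd-p odd-q ⟩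
    1+x^ p *ₚ geom (-x ^ₚ p) q               ≈⟨ *ₚ-congʳ (geom (-x ^ₚ p) q) (*-identityʳ (1+x^ p)) ⟨
    (1+x^ p *ₚ oneₚ) *ₚ geom (-x ^ₚ p) q     ∎
    where
    open ≈-Reasoning
    odd-q = ∣odd⇒odd (divides p (trans o≡qp (ℕ.*-comm q p))) (oddPart-odd j)
  ... | no _ = ≋-sym (*-identityˡ (1+x^ oddPart (suc j)))

  block-factorization : ∀ {p} s → Odd p → ∏ (λ j → 1+x^ oddPart (suc j)) s p ≋ 1+x^ p *ₚ ∏ (blockFactor p) s p
  block-factorization {p} s odd-p = begin
    ∏ (λ j → 1+x^ oddPart (suc j)) s p
      ≈⟨ ∏-cong s p (λ {j} _ → 1+x^oddPart-split j odd-p) ⟩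
    ∏ (λ j → 1+x^ p ^ₚ e j *ₚ blockFactor p j) s p
      ≈⟨ ∏-∙ (λ j → 1+x^ p ^ₚ e j) (blockFactor p) s p ⟩
    ∏ (λ j → 1+x^ p ^ₚ e j) s p *ₚ ∏ (blockFactor p) s p
      ≈⟨ *ₚ-congʳ (∏ (blockFactor p) s p) (∏-^ₚ (1+x^ p) e s p) ⟩
    1+x^ p ^ₚ ∑ e s p *ₚ ∏ (blockFactor p) s p
      ≈⟨ *ₚ-congʳ (∏ (blockFactor p) s p) (≋-reflexive (cong (1+x^ p ^ₚ_) ∑e≡1)) ⟩
    (1+x^ p *ₚ oneₚ) *ₚ ∏ (blockFactor p) s p
      ≈⟨ *ₚ-congʳ (∏ (blockFactor p) s p) (*-identityʳ (1+x^ p)) ⟩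
    1+x^ p *ₚ ∏ (blockFactor p) s p ∎
    where
    open ≈-Reasoning
    instance _ = odd⇒nonZero odd-p
    e : ℕ → ℕ
    e j = indicator (p ∣? oddPart (suc j))
    ∑e≡1 : ∑ e s p ≡ 1
    ∑e≡1 = trans (∑-cong s p (λ {j} _ → indicator-cong (λ p∣o → ℕ.∣-trans p∣o (oddPart∣ j)) (odd∣⇒∣oddPart j odd-p) _ _))
                 (count-multiples-block p s)

  blockProduct : List ℕ → ℕ → Poly
  blockProduct []       s = oneₚ
  blockProduct (p ∷ ps) s = ∏ (blockFactor p) s p *ₚ blockProduct ps (s ℕ.+ p)

  blocks-factorization : ∀ {ps} s → All Odd ps → ∏ (λ j → 1+x^ oddPart (suc j)) s (sum ps) ≋ partFactors ps *ₚ blockProduct ps s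
  blocks-factorization s [] = ≋-sym (*-identityˡ oneₚ)
  blocks-factorization {p ∷ ps} s (odd-p ∷ odd-ps) = begin
    ∏ f s (p ℕ.+ sum ps)
      ≈⟨ ∏-+ f s p (sum ps) ⟩
    ∏ f s p *ₚ ∏ f (s ℕ.+ p) (sum ps)
      ≈⟨ *-cong (block-factorization s odd-p) (blocks-factorization (s ℕ.+ p) odd-ps) ⟩
    (1+x^ p *ₚ ∏ (blockFactor p) s p) *ₚ (partFactors ps *ₚ blockProduct ps (s ℕ.+ p))
      ≈⟨ *-interchange (1+x^ p) (∏ (blockFactor p) s p) (partFactors ps) (blockProduct ps (s ℕ.+ p)) ⟩
    (1+x^ p *ₚ partFactors ps) *ₚ (∏ (blockFactor p) s p *ₚ blockProduct ps (s ℕ.+ p)) ∎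
    where
    open ≈-Reasoning
    f = λ j → 1+x^ oddPart (suc j)

  monic-partFactors : ∀ {ps} → All Odd ps → Monic (partFactors ps)
  monic-partFactors []                   = monic-oneₚ
  monic-partFactors ((k , refl) ∷ odds) = monic-*ₚ (monic-1+xPow (2 ℕ.* k)) (monic-partFactors odds)

  monic-commonFactor : ∀ n → Monic (commonFactor n)
  monic-commonFactor n = ∏-preserves {P = Monic} monic-oneₚ monic-*ₚ 0 n λ {k} _ →
    monic-^ₚ (n / suc (2 ℕ.* k) ∸ oddPartCount n (suc (2 ℕ.* k))) (monic-1+xPow (2 ℕ.* k))

  hO-factorization : ∀ n {ps} → IsOddPartition n ps → hO n ps ≋ commonFactor n *ₚ blockProduct ps 0
  hO-factorization n {ps} λ⊢n@(_ , odd , sum≡n) = monic-cancelˡ (monic-partFactors odd) (begin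
    partFactors ps *ₚ hO n ps
      ≈⟨ *-comm (partFactors ps) (hO n ps) ⟩
    hO n ps *ₚ partFactors ps
      ≈⟨ hO*partFactors n λ⊢n ⟩
    oddPowers n (λ k → n / suc (2 ℕ.* k))
      ≈⟨ commonFactor*∏ n ⟨
    commonFactor n *ₚ ∏ (λ j → 1+x^ oddPart (suc j)) 0 n
      ≡⟨ cong (λ t → commonFactor n *ₚ ∏ (λ j → 1+x^ oddPart (suc j)) 0 t) (sym sum≡n) ⟩
    commonFactor n *ₚ ∏ (λ j → 1+x^ oddPart (suc j)) 0 (sum ps)
      ≈⟨ *ₚ-congˡ (commonFactor n) (blocks-factorization 0 odd) ⟩
    commonFactor n *ₚ (partFactors ps *ₚ blockProduct ps 0)
      ≈⟨ x∙yz≈y∙xz (commonFactor n) (partFactors ps) (blockProduct ps 0) ⟩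
    partFactors ps *ₚ (commonFactor n *ₚ blockProduct ps 0) ∎)
    where open ≈-Reasoning

  blockProduct-++ : ∀ ps qs s → blockProduct (ps ++ qs) s ≋ blockProduct ps s *ₚ blockProduct qs (s ℕ.+ sum ps)
  blockProduct-++ []       qs s = ≋-trans (≋-reflexive (cong (blockProduct qs) (sym (ℕ.+-identityʳ s)))) (≋-sym (*-identityˡ _))
  blockProduct-++ (p ∷ ps) qs s = begin
    ∏ (blockFactor p) s p *ₚ blockProduct (ps ++ qs) (s ℕ.+ p)
      ≈⟨ *ₚ-congˡ (∏ (blockFactor p) s p) (blockProduct-++ ps qs (s ℕ.+ p)) ⟩
    ∏ (blockFactor p) s p *ₚ (blockProduct ps (s ℕ.+ p) *ₚ blockProduct qs (s ℕ.+ p ℕ.+ sum ps))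
      ≈⟨ *-assoc (∏ (blockFactor p) s p) _ _ ⟨
    blockProduct (p ∷ ps) s *ₚ blockProduct qs (s ℕ.+ p ℕ.+ sum ps)
      ≡⟨ cong (λ t → blockProduct (p ∷ ps) s *ₚ blockProduct qs t) (ℕ.+-assoc s p (sum ps)) ⟩
    blockProduct (p ∷ ps) s *ₚ blockProduct qs (s ℕ.+ (p ℕ.+ sum ps)) ∎
    where open ≈-Reasoning

module BlockEvaluation where
  open PolynomialRing
  open Polynomials
  open LeadingCoefficients
  open RangeProducts
  open OddParts
  open GeometricSums
  open Factorization
  open OddFactorial
  open import Data.Nat as ℕ using (ℕ; zero; suc; _<_; _≤_; z≤n; s≤s)
  import Data.Nat.Properties as ℕ
  open import Data.Nat.Divisibility as ℕ using (_∣_; _∣?_; divides)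
  open import Data.Integer as ℤ using (ℤ; +_; -_)
  import Data.Integer.Properties as ℤ
  open import Data.List using ([]; _∷_; replicate)
  open import Data.List.Relation.Unary.All as All using (All; []; _∷_)
  open import Data.Product using (_,_)
  open import Data.Sum using (_⊎_; inj₁; inj₂)
  open import Data.Empty using (⊥-elim)
  open import Relation.Nullary using (yes; no; ¬_)
  open import Relation.Binary.PropositionalEquality as ≡ using (_≡_; _≢_; refl; sym; trans; cong; subst)

  open RangeProduct ℤ.*-1-commutativeMonoid using () renaming (∏ to ∏ℤ; ∏-cong to ∏ℤ-cong; ∏-ε to ∏ℤ-1; ∏-zero to ∏ℤ-zero)

  eval-∏ : ∀ g s p x → eval (∏ g s p) x ≡ ∏ℤ (λ j → eval (g j) x) s p
  eval-∏ g s p x = ∏-homo *-commutativeMonoid ℤ.*-1-commutativeMonoid (λ q → eval q x) (eval-cst (+ 1) x) (λ q r → eval-*ₚ q r x) g s p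

  blockFactor-1 : ∀ j → blockFactor 1 j ≋ ψ (oddPart (suc j))
  blockFactor-1 j with 1 ∣? oddPart (suc j)
  ... | yes (divides q o≡q*1) = ≋-trans (geom-cong q (*-identityʳ -x)) (≋-reflexive (cong ψ (sym (trans o≡q*1 (ℕ.*-identityʳ q)))))
  ... | no ¬1∣o = ⊥-elim (¬1∣o (ℕ.1∣ _))

  eval-blockFactor-at-−1 : ∀ {p} j → ¬ p ∣ oddPart (suc j) → eval (blockFactor p j) (- + 1) ≡ + 0
  eval-blockFactor-at-−1 {p} j p∤o with p ∣? oddPart (suc j)
  ... | yes p∣o = ⊥-elim (p∤o p∣o)
  ... | no  _   = eval-1+x^-odd (oddPart-odd j)

  -- p > 1 cannot divide both o(s+1) and o(s+2), so one of the first two factors of the block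
  -- is 1 + x^(odd), which vanishes at −1.
  eval-block-at-−1 : ∀ {p} s → Odd p → p ≢ 1 → eval (∏ (blockFactor p) s p) (- + 1) ≡ + 0
  eval-block-at-−1 {p} s odd-p p≢1 = trans (eval-∏ (blockFactor p) s p (- + 1)) vanishing
    where
    2≤p = odd≢1⇒2≤ odd-p p≢1
    vanishing : ∏ℤ (λ j → eval (blockFactor p j) (- + 1)) s p ≡ + 0
    vanishing with p ∣? oddPart (suc s)
    ... | no p∤o = ∏ℤ-zero ℤ.*-zero s p s (ℕ.≤-refl , ℕ.m<m+n s (ℕ.<-trans (s≤s z≤n) 2≤p)) (eval-blockFactor-at-−1 s p∤o)
    ... | yes p∣o = ∏ℤ-zero ℤ.*-zero s p (suc s) (ℕ.n≤1+n s , subst (_< s ℕ.+ p) (ℕ.+-comm s 1) (ℕ.+-monoʳ-< s 2≤p))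
                      (eval-blockFactor-at-−1 (suc s) p∤o′)
      where
      p∤o′ : ¬ p ∣ oddPart (suc (suc s))
      p∤o′ p∣o′ = p≢1 (ℕ.∣1⇒≡1 (ℕ.∣m+n∣m⇒∣n (subst (p ∣_) (ℕ.+-comm 1 (suc s)) (ℕ.∣-trans p∣o′ (oddPart∣ (suc s))))
                                            (ℕ.∣-trans p∣o (oddPart∣ s))))

  eval-blockProduct-at-−1 : ∀ {ps} s → All Odd ps → All (_≡ 1) ps ⊎ eval (blockProduct ps s) (- + 1) ≡ + 0
  eval-blockProduct-at-−1 s [] = inj₁ []
  eval-blockProduct-at-−1 {p ∷ ps} s (odd-p ∷ odds) with p ℕ.≟ 1 | eval-blockProduct-at-−1 (s ℕ.+ p) odds
  ... | no p≢1   | _           = inj₂ (eval-*ₚ-zeroˡ (∏ (blockFactor p) s p) _ {x = - + 1} (eval-block-at-−1 s odd-p p≢1))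
  ... | yes refl | inj₁ ones   = inj₁ (refl ∷ ones)
  ... | yes refl | inj₂ rest≡0 = inj₂ (eval-*ₚ-zeroʳ (∏ (blockFactor 1) s 1) _ {x = - + 1} rest≡0)

  blockProduct-ones : ∀ r s → blockProduct (replicate r 1) s ≋ ∏ (λ j → ψ (oddPart (suc j))) s r
  blockProduct-ones zero    s = ≋-refl
  blockProduct-ones (suc r) s = *-cong (≋-trans (*-identityʳ (blockFactor 1 s)) (blockFactor-1 s))
    (≋-trans (blockProduct-ones r (s ℕ.+ 1)) (≋-reflexive (cong (λ t → ∏ (λ j → ψ (oddPart (suc j))) t r) (ℕ.+-comm s 1))))

  eval-blockProduct-ones-at-−1 : ∀ n → eval (blockProduct (replicate n 1) 0) (- + 1) ≡ + oddFactorial n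
  eval-blockProduct-ones-at-−1 n = begin
    eval (blockProduct (replicate n 1) 0) (- + 1)
      ≡⟨ eval-cong (- + 1) (blockProduct-ones n 0) ⟩
    eval (∏ (λ j → ψ (oddPart (suc j))) 0 n) (- + 1)
      ≡⟨ eval-∏ (λ j → ψ (oddPart (suc j))) 0 n (- + 1) ⟩
    ∏ℤ (λ j → eval (ψ (oddPart (suc j))) (- + 1)) 0 n
      ≡⟨ ∏ℤ-cong 0 n (λ {j} _ → eval-ψ-at-−1 (oddPart (suc j))) ⟩
    ∏ℤ (λ j → + oddPart (suc j)) 0 n
      ≡⟨ ∏-homo ℕ.*-1-commutativeMonoid ℤ.*-1-commutativeMonoid +_ refl ℤ.pos-* (λ j → oddPart (suc j)) 0 n ⟨
    + oddFactorial n ∎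
    where open ≡.≡-Reasoning

  eval-blockProduct-ones-at-0 : ∀ n → eval (blockProduct (replicate n 1) 0) (+ 0) ≡ + 1
  eval-blockProduct-ones-at-0 n = begin
    eval (blockProduct (replicate n 1) 0) (+ 0)
      ≡⟨ eval-cong (+ 0) (blockProduct-ones n 0) ⟩
    eval (∏ (λ j → ψ (oddPart (suc j))) 0 n) (+ 0)
      ≡⟨ eval-∏ (λ j → ψ (oddPart (suc j))) 0 n (+ 0) ⟩
    ∏ℤ (λ j → eval (ψ (oddPart (suc j))) (+ 0)) 0 n
      ≡⟨ ∏ℤ-1 0 n (λ {j} _ → ψ-at-0 (oddPart-odd j)) ⟩
    + 1 ∎
    where
    open ≡.≡-Reasoning
    ψ-at-0 : ∀ {a} → Odd a → eval (ψ a) (+ 0) ≡ + 1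
    ψ-at-0 (k , refl) = eval-ψ-at-0 (2 ℕ.* k)

module Ideals where
  open PolynomialRing
  open Polynomials
  open LeadingCoefficients
  open RangeProducts
  open OddParts
  open GeometricSums
  open Multiples using (¬∣-between-multiples)
  open OddPartitions
  open Factorization
  open BlockEvaluation
  open import Data.Nat as ℕ using (ℕ; zero; suc; _<_; _≤_; z≤n; s≤s; _∸_)
  import Data.Nat.Properties as ℕ
  open import Data.Nat.Divisibility as ℕ using (_∣_; _∣?_; divides)
  open import Data.Nat.GCD using (gcd; gcd-GCD; gcd[m,n]∣m; gcd[m,n]∣n; module Bézout)
  open import Data.Integer as ℤ using (+_)
  import Data.Integer.Properties as ℤ
  open import Data.List using (_++_; replicate)
  open import Data.Product using (∃; _×_; _,_; proj₁; proj₂)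
  open import Data.Empty using (⊥-elim)
  open import Data.Nat.DivMod using (_/_; _%_; m/n*n≤m; m%n≡m∸m/n*n; m%n<n)
  open import Data.Nat.Induction using (<-rec)
  open import Relation.Nullary using (yes; no; ¬_)
  open import Relation.Unary using (_⊆_)
  open import Relation.Binary.PropositionalEquality as ≡ using (_≡_; refl; sym; subst)

  record IsIdeal (I : Poly → Set) : Set where
    field
      ∈-resp-≋  : ∀ {p q} → p ≋ q → I p → I q
      +-closed  : ∀ {p q} → I p → I q → I (p +ₚ q)
      *-closedˡ : ∀ r {p} → I p → I (r *ₚ p)
  open IsIdeal

  infix 5 _∶_
  _∶_ : (Poly → Set) → Poly → Poly → Set
  (I ∶ F) W = I (F *ₚ W)

  ∶-isIdeal : ∀ {I} F → IsIdeal I → IsIdeal (I ∶ F)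
  ∶-isIdeal F ideal = record
    { ∈-resp-≋  = λ p≋q → ∈-resp-≋ ideal (*ₚ-congˡ F p≋q)
    ; +-closed  = λ {p} {q} Fp Fq → ∈-resp-≋ ideal (≋-sym (distribˡ F p q)) (+-closed ideal Fp Fq)
    ; *-closedˡ = λ r {p} Fp → ∈-resp-≋ ideal (x∙yz≈y∙xz r F p) (*-closedˡ ideal r Fp) }

  ∣ₚ-isIdeal : ∀ E → IsIdeal (E ∣ₚ_)
  ∣ₚ-isIdeal E = record
    { ∈-resp-≋ = resp ; +-closed = λ {p} {q} → closed-+ {p} {q} ; *-closedˡ = λ t {p} → closed-* t {p} }
    where
    resp : ∀ {p q} → p ≋ q → E ∣ₚ p → E ∣ₚ q
    resp {p} p≋q (r , Er≈p) = r , coeff-≡ (≋-trans (coeffwise {E *ₚ r} {p} Er≈p) p≋q)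
    closed-+ : ∀ {p q} → E ∣ₚ p → E ∣ₚ q → E ∣ₚ p +ₚ q
    closed-+ {p} {q} (r , Er≈p) (s , Es≈q) =
      r +ₚ s , coeff-≡ (≋-trans (distribˡ E r s) (+-cong (coeffwise {E *ₚ r} {p} Er≈p) (coeffwise {E *ₚ s} {q} Es≈q)))
    closed-* : ∀ t {p} → E ∣ₚ p → E ∣ₚ t *ₚ p
    closed-* t {p} (r , Er≈p) = t *ₚ r , coeff-≡ (≋-trans (x∙yz≈y∙xz E t r) (*ₚ-congˡ t (coeffwise {E *ₚ r} {p} Er≈p)))

  module _ {I} (ideal : IsIdeal I) where

    ∶-*-⊆ : ∀ {F₁ G₁ F₂ G₂} → I ∶ F₁ ⊆ I ∶ G₁ → I ∶ F₂ ⊆ I ∶ G₂ → I ∶ F₁ *ₚ F₂ ⊆ I ∶ G₁ *ₚ G₂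
    ∶-*-⊆ {F₁} {G₁} {F₂} {G₂} F₁⊆G₁ F₂⊆G₂ {W} F₁F₂W =
      ∈-resp-≋ ideal (≋-trans (x∙yz≈y∙xz G₂ G₁ W) (≋-sym (*-assoc G₁ G₂ W)))
        (F₂⊆G₂ (∈-resp-≋ ideal (x∙yz≈y∙xz G₁ F₂ W)
          (F₁⊆G₁ (∈-resp-≋ ideal (*-assoc F₁ F₂ W) F₁F₂W))))

    ∶-⊆-∈⟨⟩ : ∀ {a b c} → I a → c ∈⟨ a , b ⟩ → I ∶ b ⊆ I ∶ c
    ∶-⊆-∈⟨⟩ {a} {b} {c} Ia (U , V , Ua+Vb≋c) {W} bW =
      ∈-resp-≋ ideal (≋-trans (≋-sym (distribʳ W (U *ₚ a) (V *ₚ b))) (*ₚ-congʳ W Ua+Vb≋c))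
        (+-closed ideal (∈-resp-≋ ideal (solve 3 (λ U W a → (U :* W) :* a := (U :* a) :* W) ≋-refl U W a) (*-closedˡ ideal (U *ₚ W) Ia))
                        (∈-resp-≋ ideal (≋-sym (*-assoc V b W)) (*-closedˡ ideal V bW)))
      where open ℤ[x]-Solver using (solve; _:*_; _:=_)

    ∈⇒∶oneₚ : ∀ {F} → I F → (I ∶ F) oneₚ
    ∈⇒∶oneₚ {F} = ∈-resp-≋ ideal (≋-sym (*-identityʳ F))

    ∶oneₚ⇒∈ : ∀ {F} → (I ∶ F) oneₚ → I F
    ∶oneₚ⇒∈ {F} = ∈-resp-≋ ideal (*-identityʳ F)

  module _ (n : ℕ) where

    record Admissible (I : Poly → Set) : Set where
      field
        isIdeal       : IsIdeal I
        blockProduct∈ : ∀ {ps} → IsOddPartition n ps → I (blockProduct ps 0)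
    open Admissible

    admissible-∶ : ∀ {I} W → Admissible I → Admissible (I ∶ W)
    admissible-∶ W adm = record
      { isIdeal       = ∶-isIdeal W (isIdeal adm)
      ; blockProduct∈ = λ λ⊢n → *-closedˡ (isIdeal adm) W (blockProduct∈ adm λ⊢n) }

    record Collapses (m : ℕ) : Set₁ where
      constructor collapsesTo
      field
        constant   : ℕ
        1≤constant : 1 ≤ constant
        collapse   : ∀ {I} → Admissible I → I (ψ m) → I (cst (+ constant))

    module Reduction (𝓘 : (Poly → Set) → Set) (admissible : ∀ {I} → 𝓘 I → Admissible I) where

      record ReducesToPositive (F : Poly) : Set₁ where
        constructor reducesTo
        field
          constant   : ℕ
          1≤constant : 1 ≤ constant
          trade      : ∀ {I} → 𝓘 I → I ∶ F ⊆ I ∶ cst (+ constant)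

      private
        ideal : ∀ {I} → 𝓘 I → IsIdeal I
        ideal 𝓘I = isIdeal (admissible 𝓘I)

      reduces-oneₚ : ReducesToPositive oneₚ
      reduces-oneₚ = reducesTo 1 ℕ.≤-refl λ _ F∈I → F∈I

      reduces-* : ∀ {F G} → ReducesToPositive F → ReducesToPositive G → ReducesToPositive (F *ₚ G)
      reduces-* {F} {G} (reducesTo a 1≤a F⊆a) (reducesTo b 1≤b G⊆b) =
        reducesTo (a ℕ.* b) (ℕ.*-mono-≤ 1≤a 1≤b) λ 𝓘I {W} FG∈I →
          ∈-resp-≋ (ideal 𝓘I) (*ₚ-congʳ W (cst-* a b))
            (∶-*-⊆ (ideal 𝓘I) {F} {cst (+ a)} {G} {cst (+ b)} (F⊆a 𝓘I) (G⊆b 𝓘I) FG∈I)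

      reduces-≋ : ∀ {F G} → F ≋ G → ReducesToPositive G → ReducesToPositive F
      reduces-≋ F≋G (reducesTo c 1≤c G⊆c) =
        reducesTo c 1≤c λ 𝓘I {W} F∈I → G⊆c 𝓘I (∈-resp-≋ (ideal 𝓘I) (*ₚ-congʳ W F≋G) F∈I)

      reduces-∏ : ∀ {g} s p → (∀ {j} → InRange s p j → ReducesToPositive (g j)) → ReducesToPositive (∏ g s p)
      reduces-∏ = ∏-preserves {P = ReducesToPositive} reduces-oneₚ reduces-*

      reduces-∈⟨⟩ : ∀ {a F G} → (∀ {I} → 𝓘 I → I a) → G ∈⟨ a , F ⟩ → ReducesToPositive G → ReducesToPositive F
      reduces-∈⟨⟩ a∈I G∈⟨a,F⟩ (reducesTo c 1≤c G⊆c) =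
        reducesTo c 1≤c λ 𝓘I F∈I → G⊆c 𝓘I (∶-⊆-∈⟨⟩ (ideal 𝓘I) (a∈I 𝓘I) G∈⟨a,F⟩ F∈I)

      reduces-const : ∀ {a F c} → 1 ≤ c → (∀ {I} → 𝓘 I → I a) → cst (+ c) ∈⟨ a , F ⟩ → ReducesToPositive F
      reduces-const {c = c} 1≤c a∈I c∈⟨a,F⟩ = reduces-∈⟨⟩ a∈I c∈⟨a,F⟩ (reducesTo c 1≤c λ _ c∈I → c∈I)

      collapses⇒reduces : ∀ {m} → Collapses m → ReducesToPositive (ψ m)
      collapses⇒reduces {m} (collapsesTo c 1≤c collapse) = reducesTo c 1≤c λ 𝓘I {W} ψW∈I →
        ∈-resp-≋ (ideal 𝓘I) (*-comm W (cst (+ c)))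
          (collapse (admissible-∶ W (admissible 𝓘I)) (∈-resp-≋ (ideal 𝓘I) (*-comm (ψ m) W) ψW∈I))

      reduces-∈ : ∀ {F I} (r : ReducesToPositive F) → 𝓘 I → I F → I (cst (+ ReducesToPositive.constant r))
      reduces-∈ (reducesTo c _ F⊆c) 𝓘I F∈I = ∶oneₚ⇒∈ (ideal 𝓘I) (F⊆c 𝓘I (∈⇒∶oneₚ (ideal 𝓘I) F∈I))

    -- Modulo ψ m, each factor of the block product of m^⌊n/m⌋ 1^(n mod m) trades for a
    -- positive integer: directly, or via a Bézout identity with ψ m and the induction
    -- hypothesis for some smaller odd g.
    module Step {m} (odd-m : Odd m) (ih : ∀ {g} → g < m → Odd g → Collapses g) where
      private instance _ = odd⇒nonZero odd-m
      open Reduction (λ I → Admissible I × I (ψ m)) proj₁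

      reduces-ψ : ∀ {a} → ¬ m ∣ a → ReducesToPositive (ψ a)
      reduces-ψ {a} m∤a = reduces-∈⟨⟩ proj₂ (ψ-bézout (Bézout.identity (gcd-GCD m a))) (collapses⇒reduces (ih g<m odd-g))
        where
        g<m : gcd m a < m
        g<m = ℕ.≤∧≢⇒< (ℕ.∣⇒≤ (gcd[m,n]∣m m a)) (λ g≡m → m∤a (subst (_∣ a) g≡m (gcd[m,n]∣n m a)))
        odd-g : Odd (gcd m a)
        odd-g = ∣odd⇒odd (gcd[m,n]∣m m a) odd-m

      reduces-blockFactor : ∀ j → ReducesToPositive (blockFactor m j)
      reduces-blockFactor j with m ∣? oddPart (suc j)
      ... | yes (divides zero    o≡0)   = ⊥-elim (ℕ.<⇒≢ (odd⇒1≤ (oddPart-odd j)) (sym o≡0))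
      ... | yes (divides (suc q) _)     = reduces-const (s≤s z≤n) proj₂ (const∈⟨ψ,geom⟩ m (suc q))
      ... | no m∤o = reduces-≋ (1+x^-factor (oddPart-odd j))
                       (reduces-* (reduces-const (odd⇒1≤ odd-m) proj₂ (const∈⟨ψ,1+x⟩ m)) (reduces-ψ m∤o))

      reduces-replicate : ∀ k s → ReducesToPositive (blockProduct (replicate k m) s)
      reduces-replicate zero    s = reduces-oneₚ
      reduces-replicate (suc k) s = reduces-* (reduces-∏ s m (λ {j} _ → reduces-blockFactor j)) (reduces-replicate k (s ℕ.+ m))

      reduces-ones : ∀ r s → (∀ {j} → InRange s r j → ¬ m ∣ suc j) → ReducesToPositive (blockProduct (replicate r 1) s)
      reduces-ones r s gap = reduces-≋ (blockProduct-ones r s)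
        (reduces-∏ s r (λ {j} j∈ → reduces-ψ (λ m∣o → gap j∈ (ℕ.∣-trans m∣o (oddPart∣ j)))))

      collapses : Collapses m
      collapses = collapsesTo _ (ReducesToPositive.1≤constant reduces)
        λ adm ψm∈I → reduces-∈ reduces (adm , ψm∈I) (Admissible.blockProduct∈ adm λₘ⊢n)
        where
        k = n / m
        r = n ∸ k ℕ.* m
        km≤n : k ℕ.* m ≤ n
        km≤n = m/n*n≤m n m
        r<m : r < m
        r<m = subst (_< m) (m%n≡m∸m/n*n n m) (m%n<n n m)
        λₘ⊢n : IsOddPartition n (replicate k m ++ replicate r 1)
        λₘ⊢n = replicate++ones-isOddPartition k r odd-m (ℕ.m+[n∸m]≡n km≤n)
        reduces : ReducesToPositive (blockProduct (replicate k m ++ replicate r 1) 0)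
        reduces = reduces-≋ (blockProduct-++ (replicate k m) (replicate r 1) 0)
          (reduces-* (reduces-replicate k 0)
            (subst (λ t → ReducesToPositive (blockProduct (replicate r 1) t)) (sym (sum-replicate k m))
              (reduces-ones r (k ℕ.* m) λ (km≤j , j<km+r) → ¬∣-between-multiples k r<m km≤j j<km+r)))

    ψ-collapses : ∀ m → Odd m → Collapses m
    ψ-collapses = <-rec (λ m → Odd m → Collapses m) λ m rec odd-m → Step.collapses odd-m rec

    admissible-contains-positive : ∀ {I} → Admissible I → ∃ λ c → 1 ≤ c × I (cst (+ c))
    admissible-contains-positive adm = _ , ReducesToPositive.1≤constant reduces , reduces-∈ reduces adm (Admissible.blockProduct∈ adm ones⊢n)
      where
      open Reduction Admissible (λ adm → adm)
      ones⊢n : IsOddPartition n (replicate n 1)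
      ones⊢n = replicate++ones-isOddPartition {m = 1} 0 n (0 , refl) refl
      reduces : ReducesToPositive (blockProduct (replicate n 1) 0)
      reduces = reduces-≋ (blockProduct-ones n 0)
        (reduces-∏ 0 n (λ {j} _ → collapses⇒reduces (ψ-collapses (oddPart (suc j)) (oddPart-odd j))))

module CommonFactor where
  open PolynomialRing
  open Polynomials
  open LeadingCoefficients
  open GeometricSums
  open Factorization
  open OddFactorial
  open OddPartitions
  open BlockEvaluation
  open Ideals
  open import Data.Nat as ℕ using (ℕ; suc; _≤_)
  import Data.Nat.Properties as ℕ
  open import Data.Integer as ℤ using (ℤ; +_; -_)
  import Data.Integer.Properties as ℤ
  open import Data.List using ([]; _∷_; map; replicate)
  open import Data.List.Relation.Unary.All as All using (All; []; _∷_)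
  import Data.List.Relation.Unary.All.Properties as All
  open import Data.List.Relation.Unary.Any using (here; there)
  open import Data.List.Relation.Unary.Unique.Propositional using (Unique; []; _∷_)
  open import Data.List.Membership.Propositional using (_∈_)
  open import Data.Product using (∃; _×_; _,_; proj₁; proj₂)
  open import Data.Sum using (inj₁; inj₂)
  open import Data.Empty using (⊥-elim)
  open import Function.Bundles using (Equivalence)
  open import Relation.Binary.PropositionalEquality as ≡ using (_≡_; _≢_; refl; sym; trans; cong; cong₂; subst)

  sumₚ-factor : ∀ {A : Set} (f g : A → Poly) D xs → (∀ {x} → x ∈ xs → f x ≋ D *ₚ g x) →
                sumₚ (map f xs) ≋ D *ₚ sumₚ (map g xs)
  sumₚ-factor f g D []       _     = ≋-sym (*ₚ-zeroʳ D)
  sumₚ-factor f g D (x ∷ xs) f≋Dg =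
    ≋-trans (+-cong (f≋Dg (here refl)) (sumₚ-factor f g D xs (f≋Dg ∘ there))) (≋-sym (distribˡ D (g x) _))
    where open import Function using (_∘_)

  eval-sumₚ-zero : ∀ {A : Set} (f : A → Poly) x xs → (∀ {y} → y ∈ xs → eval (f y) x ≡ + 0) → eval (sumₚ (map f xs)) x ≡ + 0
  eval-sumₚ-zero f x []       _    = refl
  eval-sumₚ-zero f x (y ∷ xs) vanish =
    trans (eval-+ₚ (f y) _ x) (cong₂ ℤ._+_ (vanish (here refl)) (eval-sumₚ-zero f x xs (vanish ∘ there)))
    where open import Function using (_∘_)

  eval-sumₚ-single : ∀ {A : Set} (f : A → Poly) x {xs x₀} → Unique xs → x₀ ∈ xs →
                     (∀ {y} → y ∈ xs → y ≢ x₀ → eval (f y) x ≡ + 0) → eval (sumₚ (map f xs)) x ≡ eval (f x₀) x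
  eval-sumₚ-single f x {y ∷ xs} (y∉xs ∷ _) (here refl) others = begin
    eval (f y +ₚ sumₚ (map f xs)) x
      ≡⟨ eval-+ₚ (f y) _ x ⟩
    eval (f y) x ℤ.+ eval (sumₚ (map f xs)) x
      ≡⟨ cong (ℤ._+_ (eval (f y) x))
           (eval-sumₚ-zero f x xs λ z∈xs → others (there z∈xs) λ z≡y → All.lookup y∉xs z∈xs (sym z≡y)) ⟩
    eval (f y) x ℤ.+ + 0
      ≡⟨ ℤ.+-identityʳ _ ⟩
    eval (f y) x ∎
    where open ≡.≡-Reasoning
  eval-sumₚ-single f x {y ∷ xs} {x₀} (y∉xs ∷ unique) (there x₀∈xs) others = begin
    eval (f y +ₚ sumₚ (map f xs)) x
      ≡⟨ eval-+ₚ (f y) _ x ⟩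
    eval (f y) x ℤ.+ eval (sumₚ (map f xs)) x
      ≡⟨ cong₂ ℤ._+_ (others (here refl) (All.lookup y∉xs x₀∈xs)) (eval-sumₚ-single f x unique x₀∈xs (others ∘ there)) ⟩
    + 0 ℤ.+ eval (f x₀) x
      ≡⟨ ℤ.+-identityˡ _ ⟩
    eval (f x₀) x ∎
    where
    open ≡.≡-Reasoning
    open import Function using (_∘_)

  positive-unit : ∀ {b t} → + 0 ℤ.< b → b ℤ.* t ≡ + 1 → b ≡ + 1
  positive-unit {+ suc b} {t} _ bt≡1 =
    cong +_ (ℕ.m*n≡1⇒m≡1 (suc b) ℤ.∣ t ∣ (trans (sym (ℤ.abs-* (+ suc b) t)) (cong ℤ.∣_∣ bt≡1)))

  positiveLeading-monic*cst : ∀ {D G b} → Monic D → b ≢ + 0 → G ≋ D *ₚ cst b → PositiveLeading G → + 0 ℤ.< b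
  positiveLeading-monic*cst {b = b} (δ , lD) b≢0 G≋Db (d , 0<Gd , above) =
    subst (+ 0 ℤ.<_) (trans Gd≡1b (ℤ.*-identityˡ b)) 0<Gd
    where
    Gd≡1b = proj₂ (leading-unique (λ Gd≡0 → ℤ.<-irrefl (sym Gd≡0) 0<Gd) (λ 1b≡0 → b≢0 (trans (sym (ℤ.*-identityˡ b)) 1b≡0))
                     (record { coeff-at = refl ; coeff-above = above })
                     (leading-cong (≋-sym G≋Db) (leading-*ₚ lD (leading-cst b))))

  module _ {n L} (enum : EnumeratesOddPartitions n L) where

    private
      ∈L⇒partition : ∀ {λs} → λs ∈ L → IsOddPartition n λs
      ∈L⇒partition {λs} = Equivalence.to (proj₂ enum λs)

      partition⇒∈L : ∀ {λs} → IsOddPartition n λs → λs ∈ L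
      partition⇒∈L {λs} = Equivalence.from (proj₂ enum λs)

    blockProducts : Poly
    blockProducts = sumₚ (map (λ λs → blockProduct λs 0) L)

    sum-hO≋commonFactor*blockProducts : sumₚ (map (hO n) L) ≋ commonFactor n *ₚ blockProducts
    sum-hO≋commonFactor*blockProducts =
      sumₚ-factor (hO n) (λ λs → blockProduct λs 0) (commonFactor n) L (hO-factorization n ∘ ∈L⇒partition)
      where open import Function using (_∘_)

    eval-blockProducts : eval blockProducts (- + 1) ≡ + oddFactorial n
    eval-blockProducts = trans (eval-sumₚ-single (λ λs → blockProduct λs 0) (- + 1) (proj₁ enum) ones∈L others)
                               (eval-blockProduct-ones-at-−1 n)
      where
      ones∈L : replicate n 1 ∈ L
      ones∈L = partition⇒∈L (replicate++ones-isOddPartition {m = 1} 0 n (0 , refl) refl)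
      others : ∀ {λs} → λs ∈ L → λs ≢ replicate n 1 → eval (blockProduct λs 0) (- + 1) ≡ + 0
      others λs∈L λs≢1ⁿ with ∈L⇒partition λs∈L
      ... | _ , odds , sum≡n with eval-blockProduct-at-−1 0 odds
      ...   | inj₁ ones  = ⊥-elim (λs≢1ⁿ (trans (all-ones ones) (cong (λ t → replicate t 1) sum≡n)))
      ...   | inj₂ B≡0   = B≡0

    commonFactor∣gcd : ∀ {G} → IsGCDₚ (map (hO n) L) G → commonFactor n ∣ₚ G
    commonFactor∣gcd (_ , greatest , _) = greatest (commonFactor n) (All.map⁺ (All.tabulate λ {λs} λs∈L →
      blockProduct λs 0 , coeff-≡ (≋-sym (hO-factorization n (∈L⇒partition λs∈L)))))

    cofactor∣blockProduct : ∀ {G E} → IsGCDₚ (map (hO n) L) G → commonFactor n *ₚ E ≋ G →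
                            ∀ {λs} → λs ∈ L → E ∣ₚ blockProduct λs 0
    cofactor∣blockProduct {G} {E} (G∣hs , _ , _) DE≋G {λs} λs∈L with All.lookup (All.map⁻ G∣hs) λs∈L
    ... | K , GK≈h = K , coeff-≡ (monic-cancelˡ (monic-commonFactor n) (begin
      commonFactor n *ₚ (E *ₚ K)              ≈⟨ *-assoc (commonFactor n) E K ⟨
      (commonFactor n *ₚ E) *ₚ K              ≈⟨ *ₚ-congʳ K DE≋G ⟩
      G *ₚ K                                  ≈⟨ coeffwise GK≈h ⟩
      hO n λs                                 ≈⟨ hO-factorization n (∈L⇒partition λs∈L) ⟩
      commonFactor n *ₚ blockProduct λs 0     ∎))
      where open ≈-Reasoning

    cofactor-constant : ∀ {E} → (∀ {λs} → λs ∈ L → E ∣ₚ blockProduct λs 0) → ∃ λ b → b ≢ + 0 × E ≋ cst b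
    cofactor-constant {E} E∣B = *ₚ≈cst⇒cst c≢0 (coeffwise {E *ₚ K} {cst (+ c)} EK≈c)
      where
      E-admissible : Admissible n (E ∣ₚ_)
      E-admissible = record { isIdeal = ∣ₚ-isIdeal E ; blockProduct∈ = λ λ⊢n → E∣B (partition⇒∈L λ⊢n) }
      open Σ (admissible-contains-positive n E-admissible) renaming (proj₁ to c; proj₂ to 1≤c,E∣c)
      c≢0 : + c ≢ + 0
      c≢0 c≡0 = ℕ.<⇒≢ (proj₁ 1≤c,E∣c) (sym (ℤ.+-injective c≡0))
      K = proj₁ (proj₂ 1≤c,E∣c)
      EK≈c = proj₂ (proj₂ 1≤c,E∣c)

    cofactor≋oneₚ : ∀ {G E} → PositiveLeading G → commonFactor n *ₚ E ≋ G →
                    (∀ {λs} → λs ∈ L → E ∣ₚ blockProduct λs 0) → E ≋ oneₚ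
    cofactor≋oneₚ {G} {E} positive DE≋G E∣B = ≋-trans E≋b (≋-reflexive (cong cst b≡1))
      where
      open Σ (cofactor-constant {E} E∣B) renaming (proj₁ to b; proj₂ to b≢0,E≋b)
      E≋b = proj₂ b≢0,E≋b
      0<b : + 0 ℤ.< b
      0<b = positiveLeading-monic*cst (monic-commonFactor n) (proj₁ b≢0,E≋b)
              (≋-trans (≋-sym DE≋G) (*ₚ-congˡ (commonFactor n) E≋b)) positive
      open Σ (E∣B (partition⇒∈L (replicate++ones-isOddPartition {m = 1} 0 n (0 , refl) refl))) renaming (proj₁ to K; proj₂ to EK≈B)
      b≡1 : b ≡ + 1
      b≡1 = positive-unit 0<b (begin
        b ℤ.* eval K (+ 0)
          ≡⟨ cong (ℤ._* eval K (+ 0)) (trans (sym (eval-cst b (+ 0))) (eval-cong (+ 0) (≋-sym E≋b))) ⟩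
        eval E (+ 0) ℤ.* eval K (+ 0)
          ≡⟨ eval-*ₚ E K (+ 0) ⟨
        eval (E *ₚ K) (+ 0)
          ≡⟨ eval-cong (+ 0) (coeffwise {E *ₚ K} {blockProduct (replicate n 1) 0} EK≈B) ⟩
        eval (blockProduct (replicate n 1) 0) (+ 0)
          ≡⟨ eval-blockProduct-ones-at-0 n ⟩
        + 1 ∎)
        where open ≡.≡-Reasoning

    gcd≋commonFactor : ∀ {G} → IsGCDₚ (map (hO n) L) G → G ≋ commonFactor n
    gcd≋commonFactor {G} gcd@(_ , _ , positive) = begin
      G
        ≈⟨ DE≋G ⟨
      commonFactor n *ₚ E
        ≈⟨ *ₚ-congˡ (commonFactor n) (cofactor≋oneₚ positive DE≋G (cofactor∣blockProduct {G} gcd DE≋G)) ⟩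
      commonFactor n *ₚ oneₚ
        ≈⟨ *-identityʳ (commonFactor n) ⟩
      commonFactor n ∎
      where
      open ≈-Reasoning
      open Σ (commonFactor∣gcd {G} gcd) renaming (proj₁ to E; proj₂ to DE≈G)
      DE≋G = coeffwise {commonFactor n *ₚ E} {G} DE≈G

open PolynomialRing using (_≋_; coeffwise; *ₚ-congˡ)
open Polynomials using (module ≈-Reasoning; *-comm; eval-cong)
open LeadingCoefficients using (monic-cancelˡ)
open OddFactorial using (oddFactorial; oddFactorial-largestOddDivisor)
open Factorization using (commonFactor; monic-commonFactor)
open CommonFactor using (blockProducts; sum-hO≋commonFactor*blockProducts; eval-blockProducts; gcd≋commonFactor)
open import Data.Product using (_,_)
open import Relation.Binary.PropositionalEquality using (trans)

theorem3 : (n : ℕ) → n ≥ 1 →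
    (L : List (List ℕ)) → EnumeratesOddPartitions n L →
    (G : Poly) → IsGCDₚ (map (hO n) L) G →
    (N : Poly) → N *ₚ G ≈ₚ sumₚ (map (hO n) L) →
    Σ ℕ (λ d → (eval N (- (+ 1)) ≡ + d) × IsLargestOddDivisor d (n !))
theorem3 n _ L enum G gcd N NG≈Σh = oddFactorial n , eval-N , oddFactorial-largestOddDivisor n
  where
  N≋blockProducts : N ≋ blockProducts enum
  N≋blockProducts = monic-cancelˡ (monic-commonFactor n) (begin
    commonFactor n *ₚ N              ≈⟨ *-comm (commonFactor n) N ⟩
    N *ₚ commonFactor n              ≈⟨ *ₚ-congˡ N (gcd≋commonFactor enum {G} gcd) ⟨
    N *ₚ G                           ≈⟨ coeffwise {N *ₚ G} {sumₚ (map (hO n) L)} NG≈Σh ⟩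
    sumₚ (map (hO n) L)              ≈⟨ sum-hO≋commonFactor*blockProducts enum ⟩
    commonFactor n *ₚ blockProducts enum ∎)
    where open ≈-Reasoning
  eval-N : eval N (- (+ 1)) ≡ + oddFactorial n
  eval-N = trans (eval-cong (- + 1) N≋blockProducts) (eval-blockProducts enum)
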